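{- For every positive integer $n$, the number $\omega(n)$ of distinct prime divisors of $n$ satisfies \[ \omega(n) \;=\; \nu_2\!\left( \frac{\operatorname{HW}(M(4n))}{4n+5} - (4n+1)^2 \right) - 1 , \] where $M$ is the function defined in the context.
   Context: $\nu_2(m)$ denotes the exponent of $2$ in the prime factorization of the positive integer $m$, and $\operatorname{HW}(m)$ denotes the Hamming weight of $m\in\mathbb{N}$ (the number of $1$'s in its binary representation). For integers $q>1$, $t\ge 0$, $r\ge 0$ put $G_r(q,t)=\sum_{j=0}^{t-1} j^r q^j$. For $m\in\mathbb{N}$ set $t=m+1$, $u=m+5$, $q_1=2^{2u}$, $q_2=2^{2ut}$ and define \[ M(m)=\frac{2^{u}\,(2^{2ut^2}-1)}{2^u+1}-(2^u-1)\Big[G_4(q_1,t)G_0(q_2,t)-2G_2(q_1,t)G_0(q_2,t)-2m\,G_2(q_1,t)G_1(q_2,t)+m^2G_0(q_1,t)G_2(q_2,t)+2m\,G_0(q_1,t)G_1(q_2,t)\Big]. \] -}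

module Defs where

open import Data.Nat as ℕ using (ℕ; zero; suc; _^_; _∸_; _%_; _/_)
open import Data.Nat.Primality using (prime?)
open import Data.Nat.Divisibility using (_∣?_)
open import Data.Integer as ℤ using (ℤ; +_; _-_; _*_; _+_)
open import Data.Integer.Divisibility as ℤD using ()
open import Data.List using (List; upTo; filter; length; map)
open import Data.Nat.ListAction using (sum)
open import Data.Product using (_×_)
open import Relation.Nullary using (¬_)
open import Relation.Nullary.Decidable using (_×-dec_)
open import Relation.Binary.PropositionalEquality using (_≢_)

-- ω(n): number of distinct primes p dividing n (all such p are ≤ n for n ≥ 1)
ω : ℕ → ℕ
ω n = length (filter (λ p → prime? p ×-dec (p ∣? n)) (upTo (suc n)))

-- Hamming weight: number of 1's in binary expansion (fuel m suffices, since m/2 < m)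
hwAux : ℕ → ℕ → ℕ
hwAux zero    m = 0
hwAux (suc f) m = m % 2 ℕ.+ hwAux f (m / 2)

HW : ℕ → ℕ
HW m = hwAux m m

IsNu2 : ℤ → ℕ → Set
IsNu2 x k = (x ≢ + 0) × ((+ (2 ^ k)) ℤD.∣ x) × ¬ ((+ (2 ^ suc k)) ℤD.∣ x)

-- G_r(q,t) = Σ_{j=0}^{t-1} j^r q^j   (with 0^0 = 1)
G : ℕ → ℕ → ℕ → ℕ
G r q t = sum (map (λ j → j ^ r ℕ.* q ^ j) (upTo t))

M : ℕ → ℤ
M m = + first - (+ (2 ^ u ∸ 1)) * bracket
  where
  t  = suc m
  u  = m ℕ.+ 5
  q₁ = 2 ^ (2 ℕ.* u)
  q₂ = 2 ^ (2 ℕ.* u ℕ.* t)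
  -- exact division (2^u + 1 divides 2^{2ut²} - 1)
  first : ℕ
  first = (2 ^ u ℕ.* (2 ^ (2 ℕ.* u ℕ.* (t ℕ.* t)) ∸ 1)) / (suc (2 ^ u))
  g : ℕ → ℕ → ℕ → ℤ
  g r q s = + G r q s
  bracket : ℤ
  bracket = g 4 q₁ t * g 0 q₂ t
          - + 2 * g 2 q₁ t * g 0 q₂ t
          - + 2 * + m * g 2 q₁ t * g 1 q₂ t
          + + m * + m * g 0 q₁ t * g 2 q₂ t
          + + 2 * + m * g 0 q₁ t * g 1 q₂ t

module Submission where

-- Let m = 4n, t = m + 1, u = m + 5, P = 2^u and E = P − 1. Summing the geometric series
-- hidden in the G-terms shows that M(m) is the natural number N whose digits in base 2^(2u),
-- taken in t blocks of t, are E·(P + 1 − (i² − (mj + 1))²) for i, j ≤ m; the bound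
-- (m² + 1)² ≤ P keeps these digits in range. A multiple E·c with 1 ≤ c ≤ P has exactly u
-- binary ones and E·(P + 1) has 2u, so HW(N) = u·(t² + R), where R counts the pairs with
-- i² = mj + 1, i.e. the square roots of 1 modulo m. By the Chinese remainder theorem this
-- count is multiplicative; it is 2 at 4 and at odd prime powers, and 4 at 2^(k+3). Hence
-- HW(N)/u − t² = R = 2^(ω(n)+1).

open import Defs

import Algebra.Properties.Semiring.Sum as Fin∑
open import Data.Bool using (T)
open import Data.Empty using (⊥-elim)
open import Data.Fin as Fin using (Fin; toℕ)
open import Data.Fin.Permutation using (Permutation; permutation)
open import Data.Fin.Properties using (toℕ<n; toℕ-injective; toℕ-fromℕ<; any?; injective⇒≤; punchOut-injective)
open import Data.List using (List; []; _∷_; map; filter; length; applyUpTo)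
open import Data.List.Membership.Propositional using (_∈_; _∉_)
open import Data.List.Relation.Unary.All as All using (All; []; _∷_)
open import Data.List.Relation.Unary.AllPairs using (AllPairs; []; _∷_)
open import Data.List.Relation.Unary.Any using (here; there)
open import Data.Nat
open import Data.Nat.DivMod
open import Data.Nat.Divisibility
open import Data.Nat.Induction using (<-wellFounded)
import Data.Nat.ListAction as List
open import Data.Nat.ListAction using (product)
open import Data.Nat.Primality
  using (Prime; prime?; prime[2]; ¬prime[1]; euclidsLemma; prime⇒irreducible; prime⇒nonZero; prime⇒nonTrivial)
open import Data.Nat.Primality.Factorisation using (factorise)
open import Data.Nat.Properties
open import Data.Nat.Tactic.RingSolver using (solve-∀)
open import Level using (Level)
open import Data.Product using (Σ; ∃; _×_; _,_; proj₁; proj₂)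
open import Data.Sum using (_⊎_; inj₁; inj₂; [_,_])
open import Function using (_∘_; id)
open import Function.Bundles using (_⇔_; mk⇔; Equivalence)
open import Induction.WellFounded using (Acc; acc)
open import Relation.Binary.PropositionalEquality
  using (_≡_; _≢_; refl; sym; trans; cong; cong₂; subst; subst₂; module ≡-Reasoning)
open import Relation.Nullary using (Dec; yes; no; ¬_)
open import Relation.Nullary.Decidable using (_×-dec_)
open import Relation.Unary using (Pred; Decidable)

open Fin∑ +-*-semiring
  using (sum; ∑-distrib-+; ∑-comm; *-distribˡ-sum; *-distribʳ-sum; sum-cong-≗; sum-replicate-zero; sum-permute)

private
  variable
    ℓ₁ ℓ₂ ℓ₃ : Level
    A : Set ℓ₁
    B : Set ℓ₂
    C : Set ℓ₃

-- Indicators and finite sums over ℕ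

𝟙 : Dec A → ℕ
𝟙 (yes _) = 1
𝟙 (no _)  = 0

𝟙-yes : (A? : Dec A) → A → 𝟙 A? ≡ 1
𝟙-yes (yes _) _ = refl
𝟙-yes (no ¬a) a = ⊥-elim (¬a a)

𝟙-no : (A? : Dec A) → ¬ A → 𝟙 A? ≡ 0
𝟙-no (yes a) ¬a = ⊥-elim (¬a a)
𝟙-no (no _)  _  = refl

𝟙-⇔ : (A? : Dec A) (B? : Dec B) → (A → B) → (B → A) → 𝟙 A? ≡ 𝟙 B?
𝟙-⇔ (yes _)  (yes _)  _ _ = refl
𝟙-⇔ (no _)   (no _)   _ _ = refl
𝟙-⇔ (yes a)  (no ¬b)  f _ = ⊥-elim (¬b (f a))
𝟙-⇔ (no ¬a)  (yes b)  _ g = ⊥-elim (¬a (g b))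

𝟙-× : (A? : Dec A) (B? : Dec B) → 𝟙 A? * 𝟙 B? ≡ 𝟙 (A? ×-dec B?)
𝟙-× (yes _) (yes _) = refl
𝟙-× (yes _) (no _)  = refl
𝟙-× (no _)  _       = refl

𝟙-⊎ : (A? : Dec A) (B? : Dec B) (C? : Dec C) →
  (A → B ⊎ C) → (B ⊎ C → A) → ¬ (B × C) → 𝟙 A? ≡ 𝟙 B? + 𝟙 C?
𝟙-⊎ (yes a) (yes b) (yes c) _  _    ¬bc = ⊥-elim (¬bc (b , c))
𝟙-⊎ (yes a) (yes b) (no _)  _  _    _   = refl
𝟙-⊎ (yes a) (no _)  (yes c) _  _    _   = refl
𝟙-⊎ (yes a) (no ¬b) (no ¬c) to _    _   = ⊥-elim ([ ¬b , ¬c ] (to a))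
𝟙-⊎ (no ¬a) (yes b) _       _  from _   = ⊥-elim (¬a (from (inj₁ b)))
𝟙-⊎ (no ¬a) (no _)  (yes c) _  from _   = ⊥-elim (¬a (from (inj₂ c)))
𝟙-⊎ (no _)  (no _)  (no _)  _  _    _   = refl

-- The standard library's sum over Fin n, read on ℕ-indexed terms so that its laws apply.
-- A body containing infix operators must be parenthesised: ∑[ i < n ] f i + c is (∑ f) + c.
∑< : ℕ → (ℕ → ℕ) → ℕ
∑< n f = sum {n} (f ∘ toℕ)

syntax ∑< n (λ i → e) = ∑[ i < n ] e

∑<-cong : ∀ n {f g : ℕ → ℕ} → (∀ {i} → i < n → f i ≡ g i) → ∑< n f ≡ ∑< n g
∑<-cong n f≡g = sum-cong-≗ (λ i → f≡g (toℕ<n i))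

∑<-distrib-+ : ∀ n (f g : ℕ → ℕ) → ∑[ i < n ] (f i + g i) ≡ ∑< n f + ∑< n g
∑<-distrib-+ n f g = ∑-distrib-+ {n} (f ∘ toℕ) (g ∘ toℕ)

*-distribˡ-∑< : ∀ n c (f : ℕ → ℕ) → c * ∑< n f ≡ ∑[ i < n ] (c * f i)
*-distribˡ-∑< n c f = *-distribˡ-sum {n} c (f ∘ toℕ)

*-distribʳ-∑< : ∀ n c (f : ℕ → ℕ) → ∑< n f * c ≡ ∑[ i < n ] (f i * c)
*-distribʳ-∑< n c f = *-distribʳ-sum {n} c (f ∘ toℕ)

∑<-comm : ∀ m n (f : ℕ → ℕ → ℕ) → ∑[ i < m ] ∑[ j < n ] f i j ≡ ∑[ j < n ] ∑[ i < m ] f i j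
∑<-comm m n f = ∑-comm {m} {n} (λ i j → f (toℕ i) (toℕ j))

∑<-zero : ∀ n → ∑[ i < n ] 0 ≡ 0
∑<-zero = sum-replicate-zero

∑<-const : ∀ n c → ∑[ i < n ] c ≡ n * c
∑<-const zero    c = refl
∑<-const (suc n) c = cong (c +_) (∑<-const n c)

∑<-+ : ∀ m n (f : ℕ → ℕ) → ∑< (m + n) f ≡ ∑< m f + ∑[ i < n ] f (m + i)
∑<-+ zero    n f = refl
∑<-+ (suc m) n f = trans (cong (f 0 +_) (∑<-+ m n (f ∘ suc))) (sym (+-assoc (f 0) _ _))

∑<-suc : ∀ n (f : ℕ → ℕ) → ∑< (suc n) f ≡ ∑< n f + f n
∑<-suc n f = begin
  ∑< (suc n) f              ≡⟨ cong (λ k → ∑< k f) (+-comm 1 n) ⟩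
  ∑< (n + 1) f              ≡⟨ ∑<-+ n 1 f ⟩
  ∑< n f + (f (n + 0) + 0)  ≡⟨ cong (∑< n f +_) (trans (+-identityʳ _) (cong f (+-identityʳ n))) ⟩
  ∑< n f + f n              ∎
  where open ≡-Reasoning

∑<-* : ∀ m n (f : ℕ → ℕ) → ∑< (m * n) f ≡ ∑[ r < m ] ∑[ s < n ] f (r * n + s)
∑<-* zero    n f = refl
∑<-* (suc m) n f = begin
  ∑< (n + m * n) f                                    ≡⟨ ∑<-+ n (m * n) f ⟩
  ∑< n f + ∑[ i < m * n ] f (n + i)                   ≡⟨ cong (∑< n f +_) (∑<-* m n (λ i → f (n + i))) ⟩
  ∑< n f + ∑[ r < m ] ∑[ s < n ] f (n + (r * n + s))  ≡⟨ cong (∑< n f +_) (∑<-cong m λ {r} _ → ∑<-cong n λ {s} _ →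
                                                           cong f (sym (+-assoc n (r * n) s))) ⟩
  ∑< n f + ∑[ r < m ] ∑[ s < n ] f (suc r * n + s)    ∎
  where open ≡-Reasoning

∑<-indicator : ∀ n {a} → a < n → ∑[ i < n ] 𝟙 (i ≟ a) ≡ 1
∑<-indicator (suc n) {zero}  _          =
  cong suc (trans (∑<-cong n λ {i} _ → 𝟙-no (suc i ≟ 0) λ ()) (∑<-zero n))
∑<-indicator (suc n) {suc a} (s≤s a<n) =
  trans (∑<-cong n λ {i} _ → 𝟙-⇔ (suc i ≟ suc a) (i ≟ a) suc-injective (cong suc)) (∑<-indicator n a<n)

injective⇒onto : ∀ {n} (f : Fin n → Fin n) → (∀ {x y} → f x ≡ f y → x ≡ y) → ∀ y → ∃ λ x → f x ≡ y
injective⇒onto {suc n} f f-inj y with any? (λ x → f x Fin.≟ y)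
... | yes hit = hit
... | no miss = ⊥-elim (<-irrefl refl (injective⇒≤ {f = g} g-inj))
  where
  g : Fin (suc n) → Fin n
  g x = Fin.punchOut {i = y} {j = f x} (λ eq → miss (x , sym eq))
  g-inj : ∀ {x x′} → g x ≡ g x′ → x ≡ x′
  g-inj {x} {x′} eq = f-inj (punchOut-injective {i = y} (λ e → miss (x , sym e)) (λ e → miss (x′ , sym e)) eq)

∑<-reindex : ∀ n (π h : ℕ → ℕ) → (∀ {x} → x < n → π x < n) → (∀ {x y} → x < n → y < n → π x ≡ π y → x ≡ y) →
  ∑[ x < n ] h (π x) ≡ ∑< n h
∑<-reindex n π h π< π-inj = begin
  ∑[ x < n ] h (π x)           ≡⟨ sum-cong-≗ (λ i → cong h (sym (toℕ-fromℕ< (π< (toℕ<n i))))) ⟩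
  sum (λ i → h (toℕ (πF i)))   ≡⟨ sym (sum-permute (h ∘ toℕ) perm) ⟩
  ∑< n h                       ∎
  where
  open ≡-Reasoning
  πF : Fin n → Fin n
  πF i = Fin.fromℕ< (π< (toℕ<n i))
  πF-inj : ∀ {i j} → πF i ≡ πF j → i ≡ j
  πF-inj {i} {j} eq = toℕ-injective (π-inj (toℕ<n i) (toℕ<n j)
    (trans (sym (toℕ-fromℕ< _)) (trans (cong toℕ eq) (toℕ-fromℕ< _))))
  onto : ∀ y → ∃ λ x → πF x ≡ y
  onto = injective⇒onto πF πF-inj
  perm : Permutation n n
  perm = permutation πF (proj₁ ∘ onto) (proj₂ ∘ onto) (λ x → πF-inj (proj₂ (onto (πF x))))

sum-map-applyUpTo : ∀ n (f g : ℕ → ℕ) → List.sum (map f (applyUpTo g n)) ≡ ∑[ i < n ] f (g i)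
sum-map-applyUpTo zero    f g = refl
sum-map-applyUpTo (suc n) f g = cong (f (g 0) +_) (sum-map-applyUpTo n f (g ∘ suc))

length-filter-applyUpTo : ∀ {P : Pred ℕ ℓ₁} (P? : Decidable P) n (g : ℕ → ℕ) →
  length (filter P? (applyUpTo g n)) ≡ ∑[ i < n ] 𝟙 (P? (g i))
length-filter-applyUpTo P? zero    g = refl
length-filter-applyUpTo P? (suc n) g with P? (g 0)
... | yes _ = cong suc (length-filter-applyUpTo P? n (g ∘ suc))
... | no _  = length-filter-applyUpTo P? n (g ∘ suc)

∑∑ : ℕ → (ℕ → ℕ → ℕ) → ℕ
∑∑ n f = ∑[ j < n ] ∑[ i < n ] f i j

∑∑-cong : ∀ n {f g : ℕ → ℕ → ℕ} → (∀ {i j} → i < n → j < n → f i j ≡ g i j) → ∑∑ n f ≡ ∑∑ n g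
∑∑-cong n f≡g = ∑<-cong n λ j<n → ∑<-cong n λ i<n → f≡g i<n j<n

∑∑-distrib-+ : ∀ n (f g : ℕ → ℕ → ℕ) → ∑∑ n (λ i j → f i j + g i j) ≡ ∑∑ n f + ∑∑ n g
∑∑-distrib-+ n f g = trans (∑<-cong n λ {j} _ → ∑<-distrib-+ n (λ i → f i j) (λ i → g i j))
                           (∑<-distrib-+ n (λ j → ∑[ i < n ] f i j) (λ j → ∑[ i < n ] g i j))

*-distribˡ-∑∑ : ∀ n c (f : ℕ → ℕ → ℕ) → c * ∑∑ n f ≡ ∑∑ n (λ i j → c * f i j)
*-distribˡ-∑∑ n c f = trans (*-distribˡ-∑< n c (λ j → ∑[ i < n ] f i j))
                            (∑<-cong n λ {j} _ → *-distribˡ-∑< n c (λ i → f i j))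

∑<-*-∑< : ∀ n (f g : ℕ → ℕ) → ∑< n f * ∑< n g ≡ ∑∑ n (λ i j → f i * g j)
∑<-*-∑< n f g = trans (*-distribˡ-∑< n (∑< n f) g) (∑<-cong n λ {j} _ →
  trans (*-comm (∑< n f) (g j)) (trans (*-distribˡ-∑< n (g j) f) (∑<-cong n λ {i} _ → *-comm (g j) (f i))))

∑∑-linear : ∀ n a b c (f g h : ℕ → ℕ → ℕ) →
  a * ∑∑ n f + b * ∑∑ n g + c * ∑∑ n h ≡ ∑∑ n (λ i j → a * f i j + b * g i j + c * h i j)
∑∑-linear n a b c f g h = begin
  a * ∑∑ n f + b * ∑∑ n g + c * ∑∑ n h
    ≡⟨ cong₂ _+_ (cong₂ _+_ (*-distribˡ-∑∑ n a f) (*-distribˡ-∑∑ n b g)) (*-distribˡ-∑∑ n c h) ⟩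
  ∑∑ n (λ i j → a * f i j) + ∑∑ n (λ i j → b * g i j) + ∑∑ n (λ i j → c * h i j)
    ≡⟨ cong (_+ ∑∑ n (λ i j → c * h i j)) (sym (∑∑-distrib-+ n (λ i j → a * f i j) (λ i j → b * g i j))) ⟩
  ∑∑ n (λ i j → a * f i j + b * g i j) + ∑∑ n (λ i j → c * h i j)
    ≡⟨ sym (∑∑-distrib-+ n (λ i j → a * f i j + b * g i j) (λ i j → c * h i j)) ⟩
  ∑∑ n (λ i j → a * f i j + b * g i j + c * h i j) ∎
  where open ≡-Reasoning

∑-geometric : ∀ a n → suc (a * ∑[ i < n ] (suc a ^ i)) ≡ suc a ^ n
∑-geometric a zero    = cong suc (*-zeroʳ a)
∑-geometric a (suc n) = begin
  suc (a * (1 + ∑[ i < n ] (suc a * suc a ^ i)))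
    ≡⟨ cong (λ s → suc (a * (1 + s))) (sym (*-distribˡ-∑< n (suc a) (suc a ^_))) ⟩
  suc (a * (1 + suc a * S))
    ≡⟨ regroup a S ⟩
  suc a * suc (a * S)
    ≡⟨ cong (suc a *_) (∑-geometric a n) ⟩
  suc a * suc a ^ n ∎
  where
  open ≡-Reasoning
  S : ℕ
  S = ∑[ i < n ] (suc a ^ i)
  regroup : ∀ a S → suc (a * (1 + suc a * S)) ≡ suc a * suc (a * S)
  regroup = solve-∀


-- Parity and Hamming weight

data EvenOdd : ℕ → Set where
  even : ∀ b → EvenOdd (2 * b)
  odd  : ∀ b → EvenOdd (1 + 2 * b)

evenOdd : ∀ a → EvenOdd a
evenOdd zero = even 0
evenOdd (suc a) with evenOdd a
... | even b = odd b
... | odd b  = subst EvenOdd (*-suc 2 b) (even (suc b))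

2*≢1+2* : ∀ x y → 2 * x ≢ 1 + 2 * y
2*≢1+2* x y eq = 0≢1+n (begin
  0                ≡⟨ sym (m*n%n≡0 x 2) ⟩
  x * 2 % 2        ≡⟨ cong (_% 2) (trans (*-comm x 2) eq) ⟩
  (1 + 2 * y) % 2  ≡⟨ cong (λ z → (1 + z) % 2) (*-comm 2 y) ⟩
  (1 + y * 2) % 2  ≡⟨ [m+kn]%n≡m%n 1 y 2 ⟩
  1                ∎)
  where open ≡-Reasoning

2∤1+2* : ∀ k → 2 ∤ 1 + 2 * k
2∤1+2* k (divides q eq) = 2*≢1+2* q k (trans (*-comm 2 q) (sym eq))

hwAux-zero : ∀ f → hwAux f 0 ≡ 0
hwAux-zero zero    = refl
hwAux-zero (suc f) = hwAux-zero f

hwAux-fuel : ∀ f g m → m ≤ f → m ≤ g → hwAux f m ≡ hwAux g m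
hwAux-fuel f       g       zero    _       _       = trans (hwAux-zero f) (sym (hwAux-zero g))
hwAux-fuel (suc f) (suc g) (suc m) (s≤s m≤f) (s≤s m≤g) =
  cong (suc m % 2 +_) (hwAux-fuel f g (suc m / 2) (≤-trans half≤m m≤f) (≤-trans half≤m m≤g))
  where
  half≤m : suc m / 2 ≤ m
  half≤m = ≤-pred (m/n<m (suc m) 2 (s≤s (s≤s z≤n)))

HW-step : ∀ m → HW m ≡ m % 2 + HW (m / 2)
HW-step zero    = refl
HW-step (suc m) = cong (suc m % 2 +_)
  (hwAux-fuel m (suc m / 2) (suc m / 2) (≤-pred (m/n<m (suc m) 2 (s≤s (s≤s z≤n)))) ≤-refl)

HW-2* : ∀ b → HW (2 * b) ≡ HW b
HW-2* b rewrite *-comm 2 b = trans (HW-step (b * 2)) (cong₂ _+_ (m*n%n≡0 b 2) (cong HW (m*n/n≡m b 2)))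

HW-1+2* : ∀ b → HW (1 + 2 * b) ≡ suc (HW b)
HW-1+2* b rewrite *-comm 2 b = trans (HW-step (1 + b * 2)) (cong₂ _+_ ([m+kn]%n≡m%n 1 b 2) (cong HW [1+2b]/2≡b))
  where
  [1+2b]/2≡b : (1 + b * 2) / 2 ≡ b
  [1+2b]/2≡b = trans (+-distrib-/ 1 (b * 2) (subst (λ z → 1 + z < 2) (sym (m*n%n≡0 b 2)) ≤-refl))
                     (m*n/n≡m b 2)

HW-+-2^* : ∀ w a x → a < 2 ^ w → HW (a + 2 ^ w * x) ≡ HW a + HW x
HW-+-2^* zero    zero    x _         = cong HW (+-identityʳ x)
HW-+-2^* zero    (suc a) x (s≤s ())
HW-+-2^* (suc w) a    x a< with evenOdd a
... | even b = begin
  HW (2 * b + 2 * 2 ^ w * x)  ≡⟨ cong HW (regroup b (2 ^ w) x) ⟩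
  HW (2 * (b + 2 ^ w * x))    ≡⟨ HW-2* (b + 2 ^ w * x) ⟩
  HW (b + 2 ^ w * x)          ≡⟨ HW-+-2^* w b x (*-cancelˡ-< 2 b (2 ^ w) a<) ⟩
  HW b + HW x                 ≡⟨ cong (_+ HW x) (sym (HW-2* b)) ⟩
  HW (2 * b) + HW x           ∎
  where
  open ≡-Reasoning
  regroup : ∀ b p x → 2 * b + 2 * p * x ≡ 2 * (b + p * x)
  regroup = solve-∀
... | odd b = begin
  HW (1 + 2 * b + 2 * 2 ^ w * x)  ≡⟨ cong HW (regroup b (2 ^ w) x) ⟩
  HW (1 + 2 * (b + 2 ^ w * x))    ≡⟨ HW-1+2* (b + 2 ^ w * x) ⟩
  suc (HW (b + 2 ^ w * x))        ≡⟨ cong suc (HW-+-2^* w b x (*-cancelˡ-< 2 b (2 ^ w) (≤-<-trans (n≤1+n _) a<)) ) ⟩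
  suc (HW b + HW x)               ≡⟨ cong (_+ HW x) (sym (HW-1+2* b)) ⟩
  HW (1 + 2 * b) + HW x           ∎
  where
  open ≡-Reasoning
  regroup : ∀ b p x → 1 + 2 * b + 2 * p * x ≡ 1 + 2 * (b + p * x)
  regroup = solve-∀

HW-complement : ∀ u a c → suc (a + c) ≡ 2 ^ u → HW a + HW c ≡ u
HW-complement zero    zero    zero    _  = refl
HW-complement (suc u) a       c       eq with evenOdd a | evenOdd c
... | even a′ | even c′ = ⊥-elim (2*≢1+2* (2 ^ u) (a′ + c′) (trans (sym eq) (cong suc (sym (*-distribˡ-+ 2 a′ c′)))))
... | even a′ | odd c′  = begin
  HW (2 * a′) + HW (1 + 2 * c′)  ≡⟨ cong₂ _+_ (HW-2* a′) (HW-1+2* c′) ⟩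
  HW a′ + suc (HW c′)            ≡⟨ +-suc (HW a′) (HW c′) ⟩
  suc (HW a′ + HW c′)            ≡⟨ cong suc (HW-complement u a′ c′ (*-cancelˡ-≡ _ _ 2 (trans (regroup a′ c′) eq))) ⟩
  suc u                          ∎
  where
  open ≡-Reasoning
  regroup : ∀ a c → 2 * suc (a + c) ≡ suc (2 * a + (1 + 2 * c))
  regroup = solve-∀
... | odd a′  | even c′ = begin
  HW (1 + 2 * a′) + HW (2 * c′)  ≡⟨ cong₂ _+_ (HW-1+2* a′) (HW-2* c′) ⟩
  suc (HW a′ + HW c′)            ≡⟨ cong suc (HW-complement u a′ c′ (*-cancelˡ-≡ _ _ 2 (trans (regroup a′ c′) eq))) ⟩
  suc u                          ∎
  where
  open ≡-Reasoning
  regroup : ∀ a c → 2 * suc (a + c) ≡ suc (1 + 2 * a + 2 * c)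
  regroup = solve-∀
... | odd a′  | odd c′  = ⊥-elim (2*≢1+2* (2 ^ u) (1 + a′ + c′) (trans (sym eq) (regroup a′ c′)))
  where
  regroup : ∀ a c → suc (1 + 2 * a + (1 + 2 * c)) ≡ 1 + 2 * (1 + a + c)
  regroup = solve-∀

HW-mersenne-* : ∀ u E c → suc E ≡ 2 ^ u → 1 ≤ c → c ≤ 2 ^ u → HW (E * c) ≡ u
HW-mersenne-* u E (suc c) sucE≡ _ c<2^u = begin
  HW (E * suc c)                ≡⟨ cong HW split ⟩
  HW (E ∸ c + 2 ^ u * c)        ≡⟨ HW-+-2^* u (E ∸ c) c (≤-trans (s≤s (m∸n≤m E c)) (≤-reflexive sucE≡)) ⟩
  HW (E ∸ c) + HW c             ≡⟨ HW-complement u (E ∸ c) c (trans (cong suc (m∸n+n≡m c≤E)) sucE≡) ⟩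
  u                             ∎
  where
  open ≡-Reasoning
  c≤E : c ≤ E
  c≤E = ≤-pred (≤-trans c<2^u (≤-reflexive (sym sucE≡)))
  split : E * suc c ≡ E ∸ c + 2 ^ u * c
  split = begin
    E * suc c                     ≡⟨ *-suc E c ⟩
    E + E * c                     ≡⟨ cong (_+ E * c) (sym (m∸n+n≡m c≤E)) ⟩
    E ∸ c + c + E * c             ≡⟨ +-assoc (E ∸ c) c (E * c) ⟩
    E ∸ c + suc E * c             ≡⟨ cong (λ z → E ∸ c + z * c) sucE≡ ⟩
    E ∸ c + 2 ^ u * c             ∎

HW-mersenne-*-suc : ∀ u E → suc E ≡ 2 ^ u → HW (E * suc (2 ^ u)) ≡ u + u
HW-mersenne-*-suc u E sucE≡ = begin
  HW (E * suc (2 ^ u))   ≡⟨ cong HW (trans (*-suc E (2 ^ u)) (cong (E +_) (*-comm E (2 ^ u)))) ⟩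
  HW (E + 2 ^ u * E)     ≡⟨ HW-+-2^* u E E (≤-reflexive sucE≡) ⟩
  HW E + HW E            ≡⟨ cong₂ _+_ HW-E HW-E ⟩
  u + u                  ∎
  where
  open ≡-Reasoning
  HW-E : HW E ≡ u
  HW-E = HW-complement u 0 E sucE≡

∑-digits-step : ∀ B T (d : ℕ → ℕ) →
  ∑[ k < suc T ] (d k * B ^ k) ≡ d 0 + B * ∑[ k < T ] (d (suc k) * B ^ k)
∑-digits-step B T d = cong₂ _+_ (*-identityʳ (d 0)) (begin
  ∑[ k < T ] (d (suc k) * (B * B ^ k))   ≡⟨ ∑<-cong T (λ {k} _ → x*[y*z]≡y*[x*z] (d (suc k)) B (B ^ k)) ⟩
  ∑[ k < T ] (B * (d (suc k) * B ^ k))   ≡⟨ sym (*-distribˡ-∑< T B (λ k → d (suc k) * B ^ k)) ⟩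
  B * ∑[ k < T ] (d (suc k) * B ^ k)     ∎)
  where
  open ≡-Reasoning
  x*[y*z]≡y*[x*z] : ∀ x y z → x * (y * z) ≡ y * (x * z)
  x*[y*z]≡y*[x*z] = solve-∀

∑-digits-< : ∀ B T (d : ℕ → ℕ) → (∀ {k} → k < T → d k < B) → ∑[ k < T ] (d k * B ^ k) < B ^ T
∑-digits-< B zero    d _     = s≤s z≤n
∑-digits-< B (suc T) d d<B = begin-strict
  ∑[ k < suc T ] (d k * B ^ k)  ≡⟨ ∑-digits-step B T d ⟩
  d 0 + B * X                 <⟨ +-monoˡ-< (B * X) (d<B (s≤s z≤n)) ⟩
  B + B * X                   ≡⟨ sym (*-suc B X) ⟩
  B * suc X                   ≤⟨ *-monoʳ-≤ B (∑-digits-< B T (d ∘ suc) (d<B ∘ s≤s)) ⟩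
  B * B ^ T                   ∎
  where
  open ≤-Reasoning
  X : ℕ
  X = ∑[ k < T ] (d (suc k) * B ^ k)

HW-∑-digits : ∀ w T (d : ℕ → ℕ) → (∀ {k} → k < T → d k < 2 ^ w) →
  HW (∑[ k < T ] (d k * (2 ^ w) ^ k)) ≡ ∑[ k < T ] HW (d k)
HW-∑-digits w zero    d _     = refl
HW-∑-digits w (suc T) d d<2^w = begin
  HW (∑[ k < suc T ] (d k * (2 ^ w) ^ k))                     ≡⟨ cong HW (∑-digits-step (2 ^ w) T d) ⟩
  HW (d 0 + 2 ^ w * ∑[ k < T ] (d (suc k) * (2 ^ w) ^ k))      ≡⟨ HW-+-2^* w (d 0) _ (d<2^w (s≤s z≤n)) ⟩
  HW (d 0) + HW (∑[ k < T ] (d (suc k) * (2 ^ w) ^ k))         ≡⟨ cong (HW (d 0) +_) (HW-∑-digits w T (d ∘ suc) (d<2^w ∘ s≤s)) ⟩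
  ∑[ k < suc T ] HW (d k)                                   ∎
  where open ≡-Reasoning


-- Divisibility and primes

%≡%⇒∣∸ : ∀ Q .{{_ : NonZero Q}} {x y} → x % Q ≡ y % Q → y ≤ x → Q ∣ x ∸ y
%≡%⇒∣∸ Q {x} {y} x≡y y≤x = divides (x / Q ∸ y / Q) (begin
  x ∸ y                                      ≡⟨ cong₂ _∸_ (m≡m%n+[m/n]*n x Q) (m≡m%n+[m/n]*n y Q) ⟩
  (x % Q + x / Q * Q) ∸ (y % Q + y / Q * Q)  ≡⟨ cong (λ r → (r + x / Q * Q) ∸ (y % Q + y / Q * Q)) x≡y ⟩
  (y % Q + x / Q * Q) ∸ (y % Q + y / Q * Q)  ≡⟨ [m+n]∸[m+o]≡n∸o (y % Q) _ _ ⟩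
  x / Q * Q ∸ y / Q * Q                      ≡⟨ sym (*-distribʳ-∸ Q (x / Q) (y / Q)) ⟩
  (x / Q ∸ y / Q) * Q                        ∎)
  where open ≡-Reasoning

∣∧<⇒≡0 : ∀ {d n} → d ∣ n → n < d → n ≡ 0
∣∧<⇒≡0 {n = zero}  _   _   = refl
∣∧<⇒≡0 {n = suc n} d∣n n<d = ⊥-elim (>⇒∤ n<d d∣n)

[r*n+s]%n≡s : ∀ r {n s} .{{_ : NonZero n}} → s < n → (r * n + s) % n ≡ s
[r*n+s]%n≡s r {n} {s} s<n = trans (cong (_% n) (+-comm (r * n) s)) (trans ([m+kn]%n≡m%n s r n) (m<n⇒m%n≡m s<n))

[r*n+s]/n≡r : ∀ r {n s} .{{_ : NonZero n}} → s < n → (r * n + s) / n ≡ r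
[r*n+s]/n≡r r {n} {s} s<n = begin
  (r * n + s) / n      ≡⟨ cong (_/ n) (+-comm (r * n) s) ⟩
  (s + r * n) / n      ≡⟨ +-distrib-/-∣ʳ s (n∣m*n r) ⟩
  s / n + r * n / n    ≡⟨ cong₂ _+_ (m<n⇒m/n≡0 s<n) (m*n/n≡m r n) ⟩
  r                    ∎
  where open ≡-Reasoning

r*n+s<m*n : ∀ {r s m n} → r < m → s < n → r * n + s < m * n
r*n+s<m*n {r} {s} {m} {n} r<m s<n = begin-strict
  r * n + s    <⟨ +-monoʳ-< (r * n) s<n ⟩
  r * n + n    ≡⟨ +-comm (r * n) n ⟩
  suc r * n    ≤⟨ *-monoˡ-≤ n r<m ⟩
  m * n        ∎
  where open ≤-Reasoning

multiple-below : ∀ {d n} k → d ∣ n → n < k * d → ∃ λ c → c < k × n ≡ c * d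
multiple-below {d} k (divides c refl) cd<kd = c , *-cancelʳ-< d c k cd<kd , refl

prime≥2 : ∀ {p} → Prime p → 2 ≤ p
prime≥2 {p} p-prime = nonTrivial⇒n>1 p {{prime⇒nonTrivial p-prime}}

prime∣^⇒∣ : ∀ {q p} k → Prime q → q ∣ p ^ k → q ∣ p
prime∣^⇒∣         zero    q-prime q∣1 = ⊥-elim (¬prime[1] (subst Prime (∣1⇒≡1 q∣1) q-prime))
prime∣^⇒∣ {p = p} (suc k) q-prime q∣p^k+1 with euclidsLemma p (p ^ k) q-prime q∣p^k+1
... | inj₁ q∣p   = q∣p
... | inj₂ q∣p^k = prime∣^⇒∣ k q-prime q∣p^k

prime^-divisor : ∀ {p m n} k → Prime p → p ∤ m → p ^ k ∣ m * n → p ^ k ∣ n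
prime^-divisor         zero    _       _   _ = 1∣ _
prime^-divisor {p} {m} {n} (suc k) p-prime p∤m p^k+1∣mn with euclidsLemma m n p-prime (m*n∣⇒m∣ p (p ^ k) p^k+1∣mn)
... | inj₁ p∣m = ⊥-elim (p∤m p∣m)
... | inj₂ (divides n′ refl) = subst (_∣ n′ * p) (*-comm (p ^ k) p) (*-monoˡ-∣ p (prime^-divisor k p-prime p∤m p^k∣mn′))
  where
  instance _ = prime⇒nonZero p-prime
  p^k∣mn′ : p ^ k ∣ m * n′
  p^k∣mn′ = *-cancelˡ-∣ p (subst (p * p ^ k ∣_) (regroup m n′ p) p^k+1∣mn)
    where
    regroup : ∀ m n′ p → m * (n′ * p) ≡ p * (m * n′)
    regroup = solve-∀

prime^-dichotomy : ∀ {p} k m n → Prime p → ¬ (p ∣ m × p ∣ n) → p ^ k ∣ m * n → p ^ k ∣ m ⊎ p ^ k ∣ n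
prime^-dichotomy {p} k m n p-prime ¬both p^k∣mn with p ∣? m
... | yes p∣m = inj₁ (prime^-divisor k p-prime (λ p∣n → ¬both (p∣m , p∣n)) (subst (p ^ k ∣_) (*-comm m n) p^k∣mn))
... | no  p∤m = inj₂ (prime^-divisor k p-prime p∤m p^k∣mn)

prime^∣∧∣⇒∣ : ∀ {p m d} k → Prime p → p ∤ m → p ^ k ∣ d → m ∣ d → p ^ k * m ∣ d
prime^∣∧∣⇒∣ {p} {m} k p-prime p∤m p^k∣d (divides e refl) =
  *-monoˡ-∣ m (prime^-divisor k p-prime p∤m (subst (p ^ k ∣_) (*-comm e m) p^k∣d))

prime-divisor : ∀ n → 2 ≤ n → ∃ λ p → Prime p × p ∣ n
prime-divisor n@(suc _) 2≤n with factorise n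
... | record { factors = [] ; isFactorisation = n≡1 } = ⊥-elim (<⇒≢ 2≤n (sym n≡1))
... | record { factors = p ∷ ps ; isFactorisation = n≡ ; factorsPrime = p-prime ∷ _ } =
  p , p-prime , divides (product ps) (trans n≡ (*-comm p (product ps)))

p-adic-split : ∀ {p} → 2 ≤ p → ∀ n → .{{NonZero n}} → ∃ λ k → ∃ λ m → n ≡ p ^ k * m × p ∤ m × 0 < m
p-adic-split {p} 2≤p n = go n (<-wellFounded n)
  where
  go : ∀ n → .{{NonZero n}} → Acc _<_ n → ∃ λ k → ∃ λ m → n ≡ p ^ k * m × p ∤ m × 0 < m
  go n (acc smaller) with p ∣? n
  ... | no p∤n = 0 , n , sym (+-identityʳ n) , p∤n , >-nonZero⁻¹ n
  ... | yes (divides q refl) with go q {{m*n≢0⇒m≢0 q}} (smaller (m<m*n q p {{m*n≢0⇒m≢0 q}} 2≤p))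
  ...   | k , m , refl , p∤m , 0<m = suc k , m , regroup (p ^ k) m p , p∤m , 0<m
    where
    regroup : ∀ x m p → x * m * p ≡ p * x * m
    regroup = solve-∀

#primeDivisors< : ℕ → ℕ → ℕ
#primeDivisors< B n = ∑[ q < B ] 𝟙 (prime? q ×-dec q ∣? n)

#primeDivisors<≡ω : ∀ {n} B → .{{NonZero n}} → n < B → #primeDivisors< B n ≡ ω n
#primeDivisors<≡ω {n} B n<B with k , refl ← m≤n⇒∃[o]m+o≡n n<B = begin
  #primeDivisors< (suc n + k) n                           ≡⟨ ∑<-+ (suc n) k (λ q → 𝟙 (divides? q)) ⟩
  #primeDivisors< (suc n) n + ∑[ i < k ] 𝟙 (divides? (suc n + i))
                                                          ≡⟨ cong (#primeDivisors< (suc n) n +_) tail≡0 ⟩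
  #primeDivisors< (suc n) n + 0                           ≡⟨ +-identityʳ (#primeDivisors< (suc n) n) ⟩
  #primeDivisors< (suc n) n                               ≡⟨ sym (length-filter-applyUpTo divides? (suc n) id) ⟩
  ω n                                                     ∎
  where
  open ≡-Reasoning
  divides? : ∀ q → Dec (Prime q × q ∣ n)
  divides? q = prime? q ×-dec q ∣? n
  tail≡0 : ∑[ i < k ] 𝟙 (divides? (suc n + i)) ≡ 0
  tail≡0 = trans (∑<-cong k λ {i} _ → 𝟙-no (divides? (suc n + i)) (>⇒∤ (s≤s (m≤m+n n i)) ∘ proj₂)) (∑<-zero k)

ω-prime^* : ∀ {p m} k → Prime p → p ∤ m → .{{_ : NonZero m}} → ω (p ^ suc k * m) ≡ suc (ω m)
ω-prime^* {p} {m} k p-prime p∤m = begin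
  ω N                                                                ≡⟨ sym (#primeDivisors<≡ω (suc N) ≤-refl) ⟩
  #primeDivisors< (suc N) N                                          ≡⟨ ∑<-cong (suc N) (λ {q} _ → split q) ⟩
  ∑[ q < suc N ] (𝟙 (q ≟ p) + 𝟙 (prime? q ×-dec q ∣? m))
    ≡⟨ ∑<-distrib-+ (suc N) (λ q → 𝟙 (q ≟ p)) (λ q → 𝟙 (prime? q ×-dec q ∣? m)) ⟩
  ∑[ q < suc N ] 𝟙 (q ≟ p) + #primeDivisors< (suc N) m
    ≡⟨ cong₂ _+_ (∑<-indicator (suc N) (s≤s p≤N)) (#primeDivisors<≡ω (suc N) (s≤s m≤N)) ⟩
  suc (ω m)                                                          ∎
  where
  open ≡-Reasoning
  instance
    _ = prime⇒nonZero p-prime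
    _ = m^n≢0 p (suc k)
    _ = m*n≢0 (p ^ suc k) m
  N : ℕ
  N = p ^ suc k * m
  p≤N : p ≤ N
  p≤N = ≤-trans (m≤m*n p (p ^ k) {{m^n≢0 p k}}) (m≤m*n (p ^ suc k) m)
  m≤N : m ≤ N
  m≤N = subst (m ≤_) (*-comm m (p ^ suc k)) (m≤m*n m (p ^ suc k))
  to : ∀ {q} → Prime q × q ∣ N → q ≡ p ⊎ (Prime q × q ∣ m)
  to {q} (q-prime , q∣N) with euclidsLemma (p ^ suc k) m q-prime q∣N
  ... | inj₂ q∣m   = inj₂ (q-prime , q∣m)
  ... | inj₁ q∣p^k with prime⇒irreducible p-prime (prime∣^⇒∣ (suc k) q-prime q∣p^k)
  ...   | inj₁ refl = ⊥-elim (¬prime[1] q-prime)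
  ...   | inj₂ q≡p  = inj₁ q≡p
  from : ∀ {q} → q ≡ p ⊎ (Prime q × q ∣ m) → Prime q × q ∣ N
  from (inj₁ refl)             = p-prime , ∣m⇒∣m*n m (∣m⇒∣m*n (p ^ k) ∣-refl)
  from (inj₂ (q-prime , q∣m))  = q-prime , ∣n⇒∣m*n (p ^ suc k) q∣m
  split : ∀ q → 𝟙 (prime? q ×-dec q ∣? N) ≡ 𝟙 (q ≟ p) + 𝟙 (prime? q ×-dec q ∣? m)
  split q = 𝟙-⊎ (prime? q ×-dec q ∣? N) (q ≟ p) (prime? q ×-dec q ∣? m) to from λ { (refl , _ , p∣m) → p∤m p∣m }


-- M(m) as a number in base 2^(2u)

m≤n⇒∣m-n∣²+2mn≡m²+n² : ∀ {m n} → m ≤ n → ∣ m - n ∣ * ∣ m - n ∣ + 2 * m * n ≡ m * m + n * n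
m≤n⇒∣m-n∣²+2mn≡m²+n² {m} m≤n with k , refl ← m≤n⇒∃[o]m+o≡n m≤n rewrite ∣m-m+n∣≡n m k = identity m k
  where
  identity : ∀ m k → k * k + 2 * m * (m + k) ≡ m * m + (m + k) * (m + k)
  identity = solve-∀

∣m-n∣²+2mn≡m²+n² : ∀ m n → ∣ m - n ∣ * ∣ m - n ∣ + 2 * m * n ≡ m * m + n * n
∣m-n∣²+2mn≡m²+n² m n with ≤-total m n
... | inj₁ m≤n = m≤n⇒∣m-n∣²+2mn≡m²+n² m≤n
... | inj₂ n≤m = begin
  ∣ m - n ∣ * ∣ m - n ∣ + 2 * m * n  ≡⟨ cong₂ (λ x y → x * x + y) (∣-∣-comm m n) (swap m n) ⟩
  ∣ n - m ∣ * ∣ n - m ∣ + 2 * n * m  ≡⟨ m≤n⇒∣m-n∣²+2mn≡m²+n² n≤m ⟩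
  n * n + m * m                      ≡⟨ +-comm (n * n) (m * m) ⟩
  m * m + n * n                      ∎
  where
  open ≡-Reasoning
  swap : ∀ m n → 2 * m * n ≡ 2 * n * m
  swap = solve-∀

G≡∑ : ∀ r q t → G r q t ≡ ∑[ i < t ] (i ^ r * q ^ i)
G≡∑ r q t = sum-map-applyUpTo t (λ i → i ^ r * q ^ i) id

G*G≡∑∑ : ∀ r s q q′ t → G r q t * G s q′ t ≡ ∑∑ t (λ i j → i ^ r * q ^ i * (j ^ s * q′ ^ j))
G*G≡∑∑ r s q q′ t = trans (cong₂ _*_ (G≡∑ r q t) (G≡∑ s q′ t))
                          (∑<-*-∑< t (λ i → i ^ r * q ^ i) (λ j → j ^ s * q′ ^ j))

G₀-geometric : ∀ {q a} t → q ≡ suc a → q ^ t ≡ suc (a * G 0 q t)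
G₀-geometric {a = a} t refl = begin
  suc a ^ t                              ≡⟨ sym (∑-geometric a t) ⟩
  suc (a * ∑[ i < t ] (suc a ^ i))       ≡⟨ cong (λ s → suc (a * s)) (∑<-cong t λ {i} _ → sym (*-identityˡ (suc a ^ i))) ⟩
  suc (a * ∑[ i < t ] (1 * suc a ^ i))   ≡⟨ cong (λ s → suc (a * s)) (sym (G≡∑ 0 (suc a) t)) ⟩
  suc (a * G 0 (suc a) t)                ∎
  where open ≡-Reasoning

square-bound : ∀ m → (m * m + 1) * (m * m + 1) ≤ 2 ^ (m + 5)
square-bound 0 = ≤ᵇ⇒≤ 1 32 _
square-bound 1 = ≤ᵇ⇒≤ 4 64 _
square-bound 2 = ≤ᵇ⇒≤ 25 128 _
square-bound 3 = ≤ᵇ⇒≤ 100 256 _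
square-bound 4 = ≤ᵇ⇒≤ 289 512 _
square-bound 5 = ≤ᵇ⇒≤ 676 1024 _
square-bound 6 = ≤ᵇ⇒≤ 1369 2048 _
square-bound (suc m@(suc (suc (suc (suc (suc (suc k))))))) = begin
  (suc m * suc m + 1) * (suc m * suc m + 1)          ≤⟨ m≤m+n _ slack ⟩
  (suc m * suc m + 1) * (suc m * suc m + 1) + slack  ≡⟨ growth k ⟩
  2 * ((m * m + 1) * (m * m + 1))                    ≤⟨ *-monoʳ-≤ 2 (square-bound m) ⟩
  2 * 2 ^ (m + 5)                                    ∎
  where
  open ≤-Reasoning
  -- 2 (m² + 1)² − ((m + 1)² + 1)² as a polynomial in k = m − 6; its coefficients are nonnegative.
  slack : ℕ
  slack = k * k * k * k + 20 * k * k * k + 140 * k * k + 376 * k + 238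
  growth : ∀ k → let m = 6 + k in
    (suc m * suc m + 1) * (suc m * suc m + 1) + (k * k * k * k + 20 * k * k * k + 140 * k * k + 376 * k + 238)
      ≡ 2 * ((m * m + 1) * (m * m + 1))
  growth = solve-∀

module Digits (m : ℕ) where

  t : ℕ
  t = suc m

  u : ℕ
  u = m + 5

  P : ℕ
  P = 2 ^ u

  E : ℕ
  E = P ∸ 1

  q₁ : ℕ
  q₁ = 2 ^ (2 * u)

  q₂ : ℕ
  q₂ = 2 ^ (2 * u * t)

  δ : ℕ → ℕ → ℕ
  δ i j = ∣ i ^ 2 - m * j + 1 ∣

  c : ℕ → ℕ → ℕ
  c i j = suc P ∸ δ i j * δ i j

  d : ℕ → ℕ → ℕ
  d i j = E * c i j

  N : ℕ
  N = ∑[ j < t ] (∑[ i < t ] (d i j * q₁ ^ i) * q₂ ^ j)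

  X : ℕ → ℕ → ℕ
  X r s = G r q₁ t * G s q₂ t

  sucE≡P : suc E ≡ P
  sucE≡P = suc-pred P {{m^n≢0 2 u}}

  q₁≡ : q₁ ≡ suc (E * suc P)
  q₁≡ = begin
    2 ^ (2 * u)              ≡⟨ cong (λ k → 2 ^ (u + k)) (+-identityʳ u) ⟩
    2 ^ (u + u)              ≡⟨ ^-distribˡ-+-* 2 u u ⟩
    P * P                    ≡⟨ cong (λ p → p * p) (sym sucE≡P) ⟩
    suc E * suc E            ≡⟨ regroup E ⟩
    suc (E * suc (suc E))    ≡⟨ cong (λ p → suc (E * suc p)) sucE≡P ⟩
    suc (E * suc P)          ∎
    where
    open ≡-Reasoning
    regroup : ∀ E → suc E * suc E ≡ suc (E * suc (suc E))
    regroup = solve-∀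

  q₂≡ : q₂ ≡ suc (E * suc P * G 0 q₁ t)
  q₂≡ = trans (sym (^-*-assoc 2 (2 * u) t)) (G₀-geometric t q₁≡)

  2^[2ut²]≡ : 2 ^ (2 * u * (t * t)) ≡ suc (E * suc P * X 0 0)
  2^[2ut²]≡ = begin
    2 ^ (2 * u * (t * t))                            ≡⟨ cong (2 ^_) (sym (*-assoc (2 * u) t t)) ⟩
    2 ^ (2 * u * t * t)                              ≡⟨ sym (^-*-assoc 2 (2 * u * t) t) ⟩
    q₂ ^ t                                           ≡⟨ G₀-geometric t q₂≡ ⟩
    suc (E * suc P * G 0 q₁ t * G 0 q₂ t)            ≡⟨ cong suc (*-assoc (E * suc P) (G 0 q₁ t) (G 0 q₂ t)) ⟩
    suc (E * suc P * X 0 0)                          ∎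
    where open ≡-Reasoning

  first≡ : (P * (2 ^ (2 * u * (t * t)) ∸ 1)) / suc P ≡ E * P * X 0 0
  first≡ = begin
    (P * (2 ^ (2 * u * (t * t)) ∸ 1)) / suc P    ≡⟨ cong (λ x → (P * (x ∸ 1)) / suc P) 2^[2ut²]≡ ⟩
    (P * (E * suc P * X 0 0)) / suc P            ≡⟨ cong (_/ suc P) (regroup E P (X 0 0)) ⟩
    (E * P * X 0 0 * suc P) / suc P              ≡⟨ m*n/n≡m (E * P * X 0 0) (suc P) ⟩
    E * P * X 0 0                                ∎
    where
    open ≡-Reasoning
    regroup : ∀ E P x → P * (E * suc P * x) ≡ E * P * x * suc P
    regroup = solve-∀

  N≡∑∑ : N ≡ ∑∑ t (λ i j → d i j * q₁ ^ i * q₂ ^ j)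
  N≡∑∑ = ∑<-cong t λ {j} _ → *-distribʳ-∑< t (q₂ ^ j) (λ i → d i j * q₁ ^ i)

  g : ℕ → ℕ → ℕ → ℕ → ℕ
  g r s i j = i ^ r * q₁ ^ i * (j ^ s * q₂ ^ j)

  X-combination : ∀ k₁ k₂ k₃ r₁ s₁ r₂ s₂ r₃ s₃ →
    k₁ * X r₁ s₁ + k₂ * X r₂ s₂ + k₃ * X r₃ s₃ ≡ ∑∑ t (λ i j → k₁ * g r₁ s₁ i j + k₂ * g r₂ s₂ i j + k₃ * g r₃ s₃ i j)
  X-combination k₁ k₂ k₃ r₁ s₁ r₂ s₂ r₃ s₃ = trans
    (cong₂ _+_ (cong₂ _+_ (cong (k₁ *_) (G*G≡∑∑ r₁ s₁ q₁ q₂ t)) (cong (k₂ *_) (G*G≡∑∑ r₂ s₂ q₁ q₂ t)))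
               (cong (k₃ *_) (G*G≡∑∑ r₃ s₃ q₁ q₂ t)))
    (∑∑-linear t k₁ k₂ k₃ (g r₁ s₁) (g r₂ s₂) (g r₃ s₃))

  d<q₁ : ∀ i j → d i j < q₁
  d<q₁ i j = ≤-trans (s≤s (*-monoʳ-≤ E (m∸n≤m (suc P) (δ i j * δ i j)))) (≤-reflexive (sym q₁≡))

  δ²≤P : ∀ {i j} → i < t → j < t → δ i j * δ i j ≤ P
  δ²≤P {i} {j} (s≤s i≤m) (s≤s j≤m) = ≤-trans (*-mono-≤ δ≤ δ≤) (square-bound m)
    where
    i²≤ : i ^ 2 ≤ m * m + 1
    i²≤ = ≤-trans (*-mono-≤ i≤m (≤-trans (≤-reflexive (*-identityʳ i)) i≤m)) (m≤m+n (m * m) 1)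
    δ≤ : δ i j ≤ m * m + 1
    δ≤ = ≤-trans (∣m-n∣≤m⊔n (i ^ 2) (m * j + 1)) (⊔-lub i²≤ (+-monoˡ-≤ 1 (*-monoʳ-≤ m j≤m)))

  c+δ²≡sucP : ∀ {i j} → i < t → j < t → c i j + δ i j * δ i j ≡ suc P
  c+δ²≡sucP i<t j<t = m∸n+n≡m (≤-trans (δ²≤P i<t j<t) (n≤1+n P))

  c-identity : ∀ {i j} → i < t → j < t →
    c i j + (i ^ 2 * i ^ 2 + m * m * (j * j) + 2 * m * j) ≡ P + (2 * i ^ 2 + 2 * m * (i ^ 2 * j))
  c-identity {i} {j} i<t j<t = +-cancelʳ-≡ D _ _ (begin
    c i j + R + D                         ≡⟨ regroup₁ (c i j) R D ⟩
    c i j + D + R                         ≡⟨ cong (_+ R) (c+δ²≡sucP i<t j<t) ⟩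
    suc P + R                             ≡⟨ regroup₂ P a m j ⟩
    P + (a * a + b * b)                   ≡⟨ cong (P +_) (sym (∣m-n∣²+2mn≡m²+n² a b)) ⟩
    P + (D + 2 * a * b)                   ≡⟨ regroup₃ P D a m j ⟩
    P + (2 * a + 2 * m * (a * j)) + D     ∎)
    where
    open ≡-Reasoning
    a b D R : ℕ
    a = i ^ 2
    b = m * j + 1
    D = δ i j * δ i j
    R = a * a + m * m * (j * j) + 2 * m * j
    regroup₁ : ∀ c R D → c + R + D ≡ c + D + R
    regroup₁ = solve-∀
    regroup₂ : ∀ P a m j → suc P + (a * a + m * m * (j * j) + 2 * m * j) ≡ P + (a * a + (m * j + 1) * (m * j + 1))
    regroup₂ = solve-∀
    regroup₃ : ∀ P D a m j → P + (D + 2 * a * (m * j + 1)) ≡ P + (2 * a + 2 * m * (a * j)) + D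
    regroup₃ = solve-∀

  N-pointwise : ∀ {i j} → i < t → j < t →
    d i j * q₁ ^ i * q₂ ^ j + E * (1 * g 4 0 i j + m * m * g 0 2 i j + 2 * m * g 0 1 i j)
      ≡ E * (P * g 0 0 i j + 2 * g 2 0 i j + 2 * m * g 2 1 i j)
  N-pointwise {i} {j} i<t j<t = begin
    E * c i j * q₁ⁱ * q₂ʲ + E * (1 * g 4 0 i j + m * m * g 0 2 i j + 2 * m * g 0 1 i j)
      ≡⟨ expandˡ E (c i j) i j m q₁ⁱ q₂ʲ ⟩
    E * (c i j + (i ^ 2 * i ^ 2 + m * m * (j * j) + 2 * m * j)) * (q₁ⁱ * q₂ʲ)
      ≡⟨ cong (λ z → E * z * (q₁ⁱ * q₂ʲ)) (c-identity i<t j<t) ⟩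
    E * (P + (2 * i ^ 2 + 2 * m * (i ^ 2 * j))) * (q₁ⁱ * q₂ʲ)
      ≡⟨ expandʳ E P i j m q₁ⁱ q₂ʲ ⟩
    E * (P * g 0 0 i j + 2 * g 2 0 i j + 2 * m * g 2 1 i j) ∎
    where
    open ≡-Reasoning
    q₁ⁱ q₂ʲ : ℕ
    q₁ⁱ = q₁ ^ i
    q₂ʲ = q₂ ^ j
    -- `i ^ k` is spelled out as its normal form, since the solver cannot read powers in ℕ.
    expandˡ : ∀ E c i j m A B →
      E * c * A * B + E * (1 * (i * (i * (i * (i * 1))) * A * (1 * B)) + m * m * (1 * A * (j * (j * 1) * B))
                           + 2 * m * (1 * A * (j * 1 * B)))
        ≡ E * (c + (i * (i * 1) * (i * (i * 1)) + m * m * (j * j) + 2 * m * j)) * (A * B)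
    expandˡ = solve-∀
    expandʳ : ∀ E P i j m A B →
      E * (P + (2 * (i * (i * 1)) + 2 * m * (i * (i * 1) * j))) * (A * B)
        ≡ E * (P * (1 * A * (1 * B)) + 2 * (i * (i * 1) * A * (1 * B)) + 2 * m * (i * (i * 1) * A * (j * 1 * B)))
    expandʳ = solve-∀

  N-identity : N + E * (X 4 0 + m * m * X 0 2 + 2 * m * X 0 1) ≡ E * (P * X 0 0 + 2 * X 2 0 + 2 * m * X 2 1)
  N-identity = begin
    N + E * (X 4 0 + m * m * X 0 2 + 2 * m * X 0 1)
      ≡⟨ cong₂ (λ n x → n + E * (x + m * m * X 0 2 + 2 * m * X 0 1)) N≡∑∑ (sym (*-identityˡ (X 4 0))) ⟩
    ∑∑ t term + E * (1 * X 4 0 + m * m * X 0 2 + 2 * m * X 0 1)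
      ≡⟨ cong (λ x → ∑∑ t term + E * x) (X-combination 1 (m * m) (2 * m) 4 0 0 2 0 1) ⟩
    ∑∑ t term + E * ∑∑ t lower
      ≡⟨ cong (∑∑ t term +_) (*-distribˡ-∑∑ t E lower) ⟩
    ∑∑ t term + ∑∑ t (λ i j → E * lower i j)
      ≡⟨ sym (∑∑-distrib-+ t term (λ i j → E * lower i j)) ⟩
    ∑∑ t (λ i j → term i j + E * lower i j)
      ≡⟨ ∑∑-cong t N-pointwise ⟩
    ∑∑ t (λ i j → E * upper i j)
      ≡⟨ sym (*-distribˡ-∑∑ t E upper) ⟩
    E * ∑∑ t upper
      ≡⟨ cong (E *_) (sym (X-combination P 2 (2 * m) 0 0 2 0 2 1)) ⟩
    E * (P * X 0 0 + 2 * X 2 0 + 2 * m * X 2 1) ∎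
    where
    open ≡-Reasoning
    term lower upper : ℕ → ℕ → ℕ
    term i j = d i j * q₁ ^ i * q₂ ^ j
    lower i j = 1 * g 4 0 i j + m * m * g 0 2 i j + 2 * m * g 0 1 i j
    upper i j = P * g 0 0 i j + 2 * g 2 0 i j + 2 * m * g 2 1 i j

  HW-d : ∀ {i j} → i < t → j < t → HW (d i j) ≡ u + u * 𝟙 (i ^ 2 ≟ m * j + 1)
  HW-d {i} {j} i<t j<t with i ^ 2 ≟ m * j + 1
  ... | yes i²≡ = begin
    HW (E * (suc P ∸ δ i j * δ i j))  ≡⟨ cong (λ x → HW (E * (suc P ∸ x * x))) (m≡n⇒∣m-n∣≡0 i²≡) ⟩
    HW (E * suc P)                    ≡⟨ HW-mersenne-*-suc u E sucE≡P ⟩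
    u + u                             ≡⟨ cong (u +_) (sym (*-identityʳ u)) ⟩
    u + u * 1                         ∎
    where open ≡-Reasoning
  ... | no i²≢ = begin
    HW (E * c i j)  ≡⟨ HW-mersenne-* u E (c i j) sucE≡P 1≤c c≤P ⟩
    u               ≡⟨ sym (trans (cong (u +_) (*-zeroʳ u)) (+-identityʳ u)) ⟩
    u + u * 0       ∎
    where
    open ≡-Reasoning
    1≤δ : 1 ≤ δ i j
    1≤δ = n≢0⇒n>0 (i²≢ ∘ ∣m-n∣≡0⇒m≡n)
    1≤c : 1 ≤ c i j
    1≤c = ≤-trans (s≤s z≤n) (≤-reflexive (sym (+-∸-assoc 1 (δ²≤P i<t j<t))))
    c≤P : c i j ≤ P
    c≤P = ∸-monoʳ-≤ (suc P) (*-mono-≤ 1≤δ 1≤δ)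

  block : ℕ → ℕ
  block j = ∑[ i < t ] (d i j * q₁ ^ i)

  block<q₂ : ∀ {j} → j < t → block j < q₂
  block<q₂ {j} _ = ≤-trans (∑-digits-< q₁ t (λ i → d i j) (λ {i} _ → d<q₁ i j)) (≤-reflexive (^-*-assoc 2 (2 * u) t))

  R : ℕ
  R = ∑∑ t (λ i j → 𝟙 (i ^ 2 ≟ m * j + 1))

  HW-N : HW N ≡ u * (t * t + R)
  HW-N = begin
    HW N                                                   ≡⟨ HW-∑-digits (2 * u * t) t block block<q₂ ⟩
    ∑[ j < t ] HW (block j)                                ≡⟨ ∑<-cong t HW-block ⟩
    ∑∑ t (λ i j → HW (d i j))                              ≡⟨ ∑∑-cong t HW-d ⟩
    ∑∑ t (λ i j → u + u * 𝟙 (i ^ 2 ≟ m * j + 1))           ≡⟨ ∑∑-distrib-+ t (λ _ _ → u) (λ i j → u * 𝟙 (i ^ 2 ≟ m * j + 1)) ⟩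
    ∑∑ t (λ _ _ → u) + ∑∑ t (λ i j → u * 𝟙 (i ^ 2 ≟ m * j + 1))
      ≡⟨ cong₂ _+_ (trans (∑<-cong t λ _ → ∑<-const t u) (∑<-const t (t * u)))
                   (sym (*-distribˡ-∑∑ t u (λ i j → 𝟙 (i ^ 2 ≟ m * j + 1)))) ⟩
    t * (t * u) + u * R                                    ≡⟨ regroup t u R ⟩
    u * (t * t + R)                                        ∎
    where
    open ≡-Reasoning
    HW-block : ∀ {j} → j < t → HW (block j) ≡ ∑[ i < t ] HW (d i j)
    HW-block {j} _ = HW-∑-digits (2 * u) t (λ i → d i j) (λ {i} _ → d<q₁ i j)
    regroup : ∀ t u R → t * (t * u) + u * R ≡ u * (t * t + R)
    regroup = solve-∀


-- Square roots of 1 modulo Q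

IsSqrt1 : (Q : ℕ) → .{{NonZero Q}} → ℕ → Set
IsSqrt1 Q x = x * x % Q ≡ 1 % Q

isSqrt1? : ∀ Q .{{_ : NonZero Q}} x → Dec (IsSqrt1 Q x)
isSqrt1? Q x = x * x % Q ≟ 1 % Q

#sqrt1 : (Q : ℕ) → .{{NonZero Q}} → ℕ
#sqrt1 Q = ∑[ x < Q ] 𝟙 (isSqrt1? Q x)

#sqrt1-cong : ∀ {a b} .{{_ : NonZero a}} .{{_ : NonZero b}} → a ≡ b → #sqrt1 a ≡ #sqrt1 b
#sqrt1-cong refl = refl

module _ (m : ℕ) .{{_ : NonZero m}} (2≤m : 2 ≤ m) where

  private
    1%m≡1 : 1 % m ≡ 1
    1%m≡1 = m<n⇒m%n≡m 2≤m

  #j-solutions : ∀ {i} → i ≤ m → ∑[ j < suc m ] 𝟙 (i ^ 2 ≟ m * j + 1) ≡ 𝟙 (isSqrt1? m i)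
  #j-solutions {i} i≤m with isSqrt1? m i
  ... | no ¬sqrt1 = trans (∑<-cong (suc m) λ {j} _ → 𝟙-no (i ^ 2 ≟ m * j + 1) (¬sqrt1 ∘ sqrt1)) (∑<-zero (suc m))
    where
    sqrt1 : ∀ {j} → i ^ 2 ≡ m * j + 1 → IsSqrt1 m i
    sqrt1 {j} i²≡ = begin
      i * i % m          ≡⟨ cong (_% m) (trans (cong (i *_) (sym (*-identityʳ i))) i²≡) ⟩
      (m * j + 1) % m    ≡⟨ cong (_% m) (trans (+-comm (m * j) 1) (cong (1 +_) (*-comm m j))) ⟩
      (1 + j * m) % m    ≡⟨ [m+kn]%n≡m%n 1 j m ⟩
      1 % m              ∎
      where open ≡-Reasoning
  ... | yes sqrt1 = trans (∑<-cong (suc m) λ {j} _ → 𝟙-⇔ (i ^ 2 ≟ m * j + 1) (j ≟ j₀) ⇒j≡j₀ ⇐j≡j₀)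
                          (∑<-indicator (suc m) j₀≤m)
    where
    j₀ : ℕ
    j₀ = i * i / m
    i*i≡ : i * i ≡ m * j₀ + 1
    i*i≡ = trans (m≡m%n+[m/n]*n (i * i) m) (trans (cong₂ _+_ (trans sqrt1 1%m≡1) (*-comm j₀ m)) (+-comm 1 (m * j₀)))
    j₀≤m : j₀ < suc m
    j₀≤m = s≤s (≤-trans (/-monoˡ-≤ m (*-mono-≤ i≤m i≤m)) (≤-reflexive (m*n/n≡m m m)))
    i^2≡i*i : i ^ 2 ≡ i * i
    i^2≡i*i = cong (i *_) (*-identityʳ i)
    ⇒j≡j₀ : ∀ {j} → i ^ 2 ≡ m * j + 1 → j ≡ j₀
    ⇒j≡j₀ {j} i²≡ = *-cancelˡ-≡ j j₀ m (+-cancelʳ-≡ 1 _ _ (trans (sym i²≡) (trans i^2≡i*i i*i≡)))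
    ⇐j≡j₀ : ∀ {j} → j ≡ j₀ → i ^ 2 ≡ m * j + 1
    ⇐j≡j₀ refl = trans i^2≡i*i i*i≡

  #solutions≡#sqrt1 : ∑∑ (suc m) (λ i j → 𝟙 (i ^ 2 ≟ m * j + 1)) ≡ #sqrt1 m
  #solutions≡#sqrt1 = begin
    ∑[ j < suc m ] ∑[ i < suc m ] 𝟙 (i ^ 2 ≟ m * j + 1)  ≡⟨ ∑<-comm (suc m) (suc m) (λ j i → 𝟙 (i ^ 2 ≟ m * j + 1)) ⟩
    ∑[ i < suc m ] ∑[ j < suc m ] 𝟙 (i ^ 2 ≟ m * j + 1)  ≡⟨ ∑<-cong (suc m) (#j-solutions ∘ ≤-pred) ⟩
    ∑[ i < suc m ] 𝟙 (isSqrt1? m i)                     ≡⟨ ∑<-suc m (λ i → 𝟙 (isSqrt1? m i)) ⟩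
    #sqrt1 m + 𝟙 (isSqrt1? m m)                         ≡⟨ cong (#sqrt1 m +_) (𝟙-no (isSqrt1? m m) m²≢1) ⟩
    #sqrt1 m + 0                                        ≡⟨ +-identityʳ (#sqrt1 m) ⟩
    #sqrt1 m                                            ∎
    where
    open ≡-Reasoning
    m²≢1 : ¬ IsSqrt1 m m
    m²≢1 eq = 0≢1+n (trans (sym (m*n%n≡0 m m)) (trans eq 1%m≡1))

module CRT (a b : ℕ) .{{_ : NonZero a}} .{{_ : NonZero b}} (a∣∧b∣⇒ab∣ : ∀ {d} → a ∣ d → b ∣ d → a * b ∣ d) where

  instance
    ab≢0 : NonZero (a * b)
    ab≢0 = m*n≢0 a b

  private
    ≤-unique : ∀ {x y} → y ≤ x → x < a * b → x % a ≡ y % a → x % b ≡ y % b → x ≡ y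
    ≤-unique {x} {y} y≤x x<ab x≡ᵃy x≡ᵇy = ≤-antisym (m∸n≡0⇒m≤n x∸y≡0) y≤x
      where
      x∸y≡0 : x ∸ y ≡ 0
      x∸y≡0 = ∣∧<⇒≡0 (a∣∧b∣⇒ab∣ (%≡%⇒∣∸ a x≡ᵃy y≤x) (%≡%⇒∣∸ b x≡ᵇy y≤x)) (≤-<-trans (m∸n≤m x y) x<ab)

  residues-injective : ∀ {x y} → x < a * b → y < a * b → x % a ≡ y % a → x % b ≡ y % b → x ≡ y
  residues-injective {x} {y} x<ab y<ab x≡ᵃy x≡ᵇy with ≤-total y x
  ... | inj₁ y≤x = ≤-unique y≤x x<ab x≡ᵃy x≡ᵇy
  ... | inj₂ x≤y = sym (≤-unique x≤y y<ab (sym x≡ᵃy) (sym x≡ᵇy))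

  sqrt1-split : ∀ x → IsSqrt1 (a * b) x ⇔ (IsSqrt1 a (x % a) × IsSqrt1 b (x % b))
  sqrt1-split x = mk⇔ (λ sqrt1 → reduce a (m∣m*n b) sqrt1 , reduce b (n∣m*n a) sqrt1)
    λ (sqrt1ᵃ , sqrt1ᵇ) → residues-injective (m%n<n (x * x) (a * b)) (m%n<n 1 (a * b))
                                             (lift a (m∣m*n b) sqrt1ᵃ) (lift b (n∣m*n a) sqrt1ᵇ)
    where
    reduce : ∀ Q .{{_ : NonZero Q}} → Q ∣ a * b → IsSqrt1 (a * b) x → IsSqrt1 Q (x % Q)
    reduce Q Q∣ab sqrt1 = begin
      (x % Q) * (x % Q) % Q   ≡⟨ sym (%-distribˡ-* x x Q) ⟩
      x * x % Q               ≡⟨ sym (m∣n⇒o%n%m≡o%m Q (a * b) (x * x) Q∣ab) ⟩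
      x * x % (a * b) % Q     ≡⟨ cong (_% Q) sqrt1 ⟩
      1 % (a * b) % Q         ≡⟨ m∣n⇒o%n%m≡o%m Q (a * b) 1 Q∣ab ⟩
      1 % Q                   ∎
      where open ≡-Reasoning
    lift : ∀ Q .{{_ : NonZero Q}} → Q ∣ a * b → IsSqrt1 Q (x % Q) → x * x % (a * b) % Q ≡ 1 % (a * b) % Q
    lift Q Q∣ab sqrt1 = begin
      x * x % (a * b) % Q     ≡⟨ m∣n⇒o%n%m≡o%m Q (a * b) (x * x) Q∣ab ⟩
      x * x % Q               ≡⟨ %-distribˡ-* x x Q ⟩
      (x % Q) * (x % Q) % Q   ≡⟨ sqrt1 ⟩
      1 % Q                   ≡⟨ sym (m∣n⇒o%n%m≡o%m Q (a * b) 1 Q∣ab) ⟩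
      1 % (a * b) % Q         ∎
      where open ≡-Reasoning

  #sqrt1-* : #sqrt1 (a * b) ≡ #sqrt1 a * #sqrt1 b
  #sqrt1-* = begin
    ∑[ x < a * b ] 𝟙 (isSqrt1? (a * b) x)           ≡⟨ ∑<-cong (a * b) (λ {x} _ → split x) ⟩
    ∑[ x < a * b ] (ρᵃ (x % a) * ρᵇ (x % b))         ≡⟨ ∑<-cong (a * b) (λ {x} _ → sym (H∘π x)) ⟩
    ∑[ x < a * b ] H (π x)                           ≡⟨ ∑<-reindex (a * b) π H π< π-inj ⟩
    ∑< (a * b) H                                     ≡⟨ ∑<-* a b H ⟩
    ∑[ r < a ] ∑[ s < b ] H (r * b + s)              ≡⟨ ∑<-cong a (λ {r} _ → ∑<-cong b λ {s} s<b → H-block r s<b) ⟩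
    ∑[ r < a ] ∑[ s < b ] (ρᵃ r * ρᵇ s)              ≡⟨ ∑<-cong a (λ {r} _ → sym (*-distribˡ-∑< b (ρᵃ r) ρᵇ)) ⟩
    ∑[ r < a ] (ρᵃ r * #sqrt1 b)                     ≡⟨ sym (*-distribʳ-∑< a (#sqrt1 b) ρᵃ) ⟩
    #sqrt1 a * #sqrt1 b                              ∎
    where
    open ≡-Reasoning
    ρᵃ ρᵇ : ℕ → ℕ
    ρᵃ r = 𝟙 (isSqrt1? a r)
    ρᵇ s = 𝟙 (isSqrt1? b s)
    split : ∀ x → 𝟙 (isSqrt1? (a * b) x) ≡ ρᵃ (x % a) * ρᵇ (x % b)
    split x = trans (𝟙-⇔ _ (isSqrt1? a (x % a) ×-dec isSqrt1? b (x % b))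
                        (Equivalence.to (sqrt1-split x)) (Equivalence.from (sqrt1-split x)))
                    (sym (𝟙-× (isSqrt1? a (x % a)) (isSqrt1? b (x % b))))
    π : ℕ → ℕ
    π x = x % a * b + x % b
    H : ℕ → ℕ
    H y = ρᵃ (y / b) * ρᵇ (y % b)
    H-block : ∀ r {s} → s < b → H (r * b + s) ≡ ρᵃ r * ρᵇ s
    H-block r s<b = cong₂ _*_ (cong ρᵃ ([r*n+s]/n≡r r s<b)) (cong ρᵇ ([r*n+s]%n≡s r s<b))
    H∘π : ∀ x → H (π x) ≡ ρᵃ (x % a) * ρᵇ (x % b)
    H∘π x = H-block (x % a) (m%n<n x b)
    π< : ∀ {x} → x < a * b → π x < a * b
    π< {x} _ = r*n+s<m*n (m%n<n x a) (m%n<n x b)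
    π-inj : ∀ {x y} → x < a * b → y < a * b → π x ≡ π y → x ≡ y
    π-inj {x} {y} x<ab y<ab πx≡πy = residues-injective x<ab y<ab
      (trans (sym ([r*n+s]/n≡r (x % a) (m%n<n x b))) (trans (cong (_/ b) πx≡πy) ([r*n+s]/n≡r (y % a) (m%n<n y b))))
      (trans (sym ([r*n+s]%n≡s (x % a) (m%n<n x b))) (trans (cong (_% b) πx≡πy) ([r*n+s]%n≡s (y % a) (m%n<n y b))))

occurrences : List ℕ → ℕ → ℕ
occurrences []      x = 0
occurrences (α ∷ L) x = 𝟙 (x ≟ α) + occurrences L x

occurrences-∉ : ∀ L {x} → x ∉ L → occurrences L x ≡ 0
occurrences-∉ []      _   = refl
occurrences-∉ (α ∷ L) x∉ = cong₂ _+_ (𝟙-no _ (x∉ ∘ here)) (occurrences-∉ L (x∉ ∘ there))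

occurrences-∈ : ∀ {L x} → AllPairs _<_ L → x ∈ L → occurrences L x ≡ 1
occurrences-∈ {α ∷ L} (α< ∷ _) (here refl) =
  cong₂ _+_ (𝟙-yes (α ≟ α) refl) (occurrences-∉ L λ α∈L → <-irrefl refl (All.lookup α< α∈L))
occurrences-∈ {α ∷ L} {x} (α< ∷ sorted) (there x∈L) =
  cong₂ _+_ (𝟙-no (x ≟ α) λ { refl → <-irrefl refl (All.lookup α< x∈L) }) (occurrences-∈ sorted x∈L)

∑<-occurrences : ∀ Q L → All (_< Q) L → ∑< Q (occurrences L) ≡ length L
∑<-occurrences Q []      []            = ∑<-zero Q
∑<-occurrences Q (α ∷ L) (α<Q ∷ L<Q)  =
  trans (∑<-distrib-+ Q (λ x → 𝟙 (x ≟ α)) (occurrences L))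
        (cong₂ _+_ (∑<-indicator Q α<Q) (∑<-occurrences Q L L<Q))

#sqrt1-list : ∀ Q .{{_ : NonZero Q}} L → AllPairs _<_ L → All (_< Q) L →
  (∀ {x} → x < Q → IsSqrt1 Q x → x ∈ L) → (∀ {x} → x ∈ L → IsSqrt1 Q x) → #sqrt1 Q ≡ length L
#sqrt1-list Q L sorted L<Q complete sound = trans (∑<-cong Q pointwise) (∑<-occurrences Q L L<Q)
  where
  pointwise : ∀ {x} → x < Q → 𝟙 (isSqrt1? Q x) ≡ occurrences L x
  pointwise {x} x<Q with isSqrt1? Q x
  ... | yes sqrt1  = sym (occurrences-∈ sorted (complete x<Q sqrt1))
  ... | no ¬sqrt1  = sym (occurrences-∉ L (¬sqrt1 ∘ sound))

IsSqrt1-suc⇒∣ : ∀ Q .{{_ : NonZero Q}} w → IsSqrt1 Q (suc w) → Q ∣ w * (w + 2)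
IsSqrt1-suc⇒∣ Q w sqrt1 = subst (Q ∣_) (identity w) (%≡%⇒∣∸ Q sqrt1 (s≤s z≤n))
  where
  identity : ∀ w → w + w * suc w ≡ w * (w + 2)
  identity = solve-∀

∣⇒IsSqrt1 : ∀ Q .{{_ : NonZero Q}} x {k} → x * x ≡ 1 + k → Q ∣ k → IsSqrt1 Q x
∣⇒IsSqrt1 Q x x*x≡ Q∣k = trans (cong (_% Q) x*x≡) (%-remove-+ʳ 1 Q∣k)

¬IsSqrt1-0 : ∀ Q .{{_ : NonZero Q}} → 2 ≤ Q → ¬ IsSqrt1 Q 0
¬IsSqrt1-0 Q 2≤Q sqrt1 = 0≢1+n (trans (sym (m<n⇒m%n≡m (<-trans z<s 2≤Q))) (trans sqrt1 (m<n⇒m%n≡m 2≤Q)))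

#sqrt1-two-roots : ∀ r → (∀ {w} → 3 + r ∣ w * (w + 2) → 3 + r ∣ w ⊎ 3 + r ∣ w + 2) → #sqrt1 (3 + r) ≡ 2
#sqrt1-two-roots r dichotomy =
  #sqrt1-list (3 + r) (1 ∷ 2 + r ∷ []) ((s≤s (s≤s z≤n) ∷ []) ∷ [] ∷ []) (s≤s (s≤s z≤n) ∷ ≤-refl ∷ [])
              complete sound
  where
  sound : ∀ {x} → x ∈ 1 ∷ 2 + r ∷ [] → IsSqrt1 (3 + r) x
  sound (here refl)         = refl
  sound (there (here refl)) = ∣⇒IsSqrt1 (3 + r) (2 + r) (square r) (n∣m*n (1 + r))
    where
    square : ∀ r → (2 + r) * (2 + r) ≡ 1 + (1 + r) * (3 + r)
    square = solve-∀
  complete : ∀ {x} → x < 3 + r → IsSqrt1 (3 + r) x → x ∈ 1 ∷ 2 + r ∷ []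
  complete {zero}  _   sqrt1 = ⊥-elim (¬IsSqrt1-0 (3 + r) (s≤s (s≤s z≤n)) sqrt1)
  complete {suc w} x<Q sqrt1 with dichotomy (IsSqrt1-suc⇒∣ (3 + r) w sqrt1)
  ... | inj₁ Q∣w   = here (cong suc (∣∧<⇒≡0 Q∣w (<-trans (n<1+n w) x<Q)))
  ... | inj₂ Q∣w+2 = there (here (suc-injective (≤-antisym x<Q (∣⇒≤ (subst (3 + r ∣_) (+-comm w 2) Q∣w+2)))))

lin< : ∀ a b c d h → T (a <ᵇ c) → T (b ≤ᵇ d) → a + b * h < c + d * h
lin< a b c d h a<c b≤d = +-mono-<-≤ (<ᵇ⇒< a c a<c) (*-monoˡ-≤ h (≤ᵇ⇒≤ b d b≤d))

#sqrt1-four-roots : ∀ h → (∀ {v} → 2 + 2 * h ∣ v * (v + 1) → 2 + 2 * h ∣ v ⊎ 2 + 2 * h ∣ v + 1) →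
  #sqrt1 (8 + 8 * h) ≡ 4
#sqrt1-four-roots h dichotomy = #sqrt1-list Q roots sorted bounded complete sound
  where
  Q H : ℕ
  Q = 8 + 8 * h
  H = 2 + 2 * h
  -- 1, 2H − 1, 2H + 1 and 4H − 1
  roots : List ℕ
  roots = 1 ∷ 3 + 4 * h ∷ 5 + 4 * h ∷ 7 + 8 * h ∷ []
  sorted : AllPairs _<_ roots
  sorted = (lin< 1 0 3 4 h _ _ ∷ lin< 1 0 5 4 h _ _ ∷ lin< 1 0 7 8 h _ _ ∷ [])
         ∷ (lin< 3 4 5 4 h _ _ ∷ lin< 3 4 7 8 h _ _ ∷ [])
         ∷ (lin< 5 4 7 8 h _ _ ∷ []) ∷ [] ∷ []
  bounded : All (_< Q) roots
  bounded = lin< 1 0 8 8 h _ _ ∷ lin< 3 4 8 8 h _ _ ∷ lin< 5 4 8 8 h _ _ ∷ lin< 7 8 8 8 h _ _ ∷ []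
  sound : ∀ {x} → x ∈ roots → IsSqrt1 Q x
  sound (here refl)                         = refl
  sound (there (here refl))                 = ∣⇒IsSqrt1 Q (3 + 4 * h) (square₃ h) (n∣m*n (1 + 2 * h))
    where
    square₃ : ∀ h → (3 + 4 * h) * (3 + 4 * h) ≡ 1 + (1 + 2 * h) * (8 + 8 * h)
    square₃ = solve-∀
  sound (there (there (here refl)))         = ∣⇒IsSqrt1 Q (5 + 4 * h) (square₅ h) (n∣m*n (3 + 2 * h))
    where
    square₅ : ∀ h → (5 + 4 * h) * (5 + 4 * h) ≡ 1 + (3 + 2 * h) * (8 + 8 * h)
    square₅ = solve-∀
  sound (there (there (there (here refl)))) = ∣⇒IsSqrt1 Q (7 + 8 * h) (square₇ h) (n∣m*n (6 + 8 * h))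
    where
    square₇ : ∀ h → (7 + 8 * h) * (7 + 8 * h) ≡ 1 + (6 + 8 * h) * (8 + 8 * h)
    square₇ = solve-∀
  H∣v[v+1] : ∀ {v} → IsSqrt1 Q (suc (2 * v)) → H ∣ v * (v + 1)
  H∣v[v+1] {v} sqrt1 = *-cancelˡ-∣ 4 (subst₂ _∣_ (quadruple h) (even-product v) (IsSqrt1-suc⇒∣ Q (2 * v) sqrt1))
    where
    quadruple : ∀ h → 8 + 8 * h ≡ 4 * (2 + 2 * h)
    quadruple = solve-∀
    even-product : ∀ v → 2 * v * (2 * v + 2) ≡ 4 * (v * (v + 1))
    even-product = solve-∀
  v<2H : ∀ {v} → suc (2 * v) < Q → v < 2 * H
  v<2H {v} x<Q = *-cancelˡ-< 2 v (2 * H) (≤-trans (n≤1+n _) (subst (suc (suc (2 * v)) ≤_) (quadruple h) x<Q))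
    where
    quadruple : ∀ h → 8 + 8 * h ≡ 2 * (2 * (2 + 2 * h))
    quadruple = solve-∀
  halve : ∀ {v T} → 2 * (v + 1) ≡ suc T → suc (2 * v) ≡ T
  halve {v} eq = suc-injective (trans (sym (double-suc v)) eq)
    where
    double-suc : ∀ v → 2 * (v + 1) ≡ suc (suc (2 * v))
    double-suc = solve-∀
  odd-root : ∀ {v} → v < 2 * H → H ∣ v ⊎ H ∣ v + 1 → suc (2 * v) ∈ roots
  odd-root v<2H (inj₁ H∣v) with multiple-below 2 H∣v v<2H
  ... | 0 , _ , refl = here refl
  ... | 1 , _ , refl = there (there (here (root₅ h)))
    where
    root₅ : ∀ h → suc (2 * (1 * (2 + 2 * h))) ≡ 5 + 4 * h
    root₅ = solve-∀
  ... | suc (suc _) , s≤s (s≤s ()) , _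
  odd-root {v} v<2H (inj₂ H∣v+1)
    with multiple-below 3 H∣v+1 (≤-<-trans (≤-reflexive (+-comm v 1)) (≤-<-trans v<2H (*-monoˡ-< H (≤-refl {3}))))
  ... | 0 , _ , v+1≡0 = ⊥-elim (1+n≢0 (trans (+-comm 1 v) v+1≡0))
  ... | 1 , _ , eq    = there (here (halve {v} (trans (cong (2 *_) eq) (root₃ h))))
    where
    root₃ : ∀ h → 2 * (1 * (2 + 2 * h)) ≡ suc (3 + 4 * h)
    root₃ = solve-∀
  ... | 2 , _ , eq    = there (there (there (here (halve {v} (trans (cong (2 *_) eq) (root₇ h))))))
    where
    root₇ : ∀ h → 2 * (2 * (2 + 2 * h)) ≡ suc (7 + 8 * h)
    root₇ = solve-∀
  ... | suc (suc (suc _)) , s≤s (s≤s (s≤s ())) , _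
  complete : ∀ {x} → x < Q → IsSqrt1 Q x → x ∈ roots
  complete {zero}  _   sqrt1 = ⊥-elim (¬IsSqrt1-0 Q (s≤s (s≤s z≤n)) sqrt1)
  complete {suc w} x<Q sqrt1 with evenOdd w
  ... | even v = odd-root (v<2H {v} x<Q) (dichotomy (H∣v[v+1] {v} sqrt1))
  ... | odd v  = ⊥-elim (2∤1+2* (2 * v * v + 4 * v + 1) (subst (2 ∣_) (odd-product v)
                   (∣-trans (divides (4 + 4 * h) (double h)) (IsSqrt1-suc⇒∣ Q (1 + 2 * v) sqrt1))))
    where
    odd-product : ∀ v → (1 + 2 * v) * (1 + 2 * v + 2) ≡ 1 + 2 * (2 * v * v + 4 * v + 1)
    odd-product = solve-∀
    double : ∀ h → 8 + 8 * h ≡ (4 + 4 * h) * 2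
    double = solve-∀

#sqrt1-odd-prime^ : ∀ {p} k → Prime p → p ≢ 2 → .{{_ : NonZero (p ^ suc k)}} → #sqrt1 (p ^ suc k) ≡ 2
#sqrt1-odd-prime^ {p} k p-prime p≢2 = trans (#sqrt1-cong (sym 3+r≡Q)) (#sqrt1-two-roots r dichotomy)
  where
  instance _ = prime⇒nonZero p-prime
  Q r : ℕ
  Q = p ^ suc k
  3≤Q : 3 ≤ Q
  3≤Q = ≤-trans (≤∧≢⇒< (prime≥2 p-prime) (p≢2 ∘ sym)) (m≤m*n p (p ^ k) {{m^n≢0 p k}})
  r = Q ∸ 3
  3+r≡Q : 3 + r ≡ Q
  3+r≡Q = m+[n∸m]≡n 3≤Q
  ¬both : ∀ {w} → ¬ (p ∣ w × p ∣ w + 2)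
  ¬both (p∣w , p∣w+2) = p≢2 (≤-antisym (∣⇒≤ (∣m+n∣m⇒∣n p∣w+2 p∣w)) (prime≥2 p-prime))
  dichotomy : ∀ {w} → 3 + r ∣ w * (w + 2) → 3 + r ∣ w ⊎ 3 + r ∣ w + 2
  dichotomy {w} Q∣ rewrite 3+r≡Q = prime^-dichotomy (suc k) w (w + 2) p-prime ¬both Q∣

#sqrt1-2^ : ∀ k → .{{_ : NonZero (2 ^ (3 + k))}} → #sqrt1 (2 ^ (3 + k)) ≡ 4
#sqrt1-2^ k = trans (#sqrt1-cong (trans (cong (λ x → 2 * (2 * (2 * x))) 2^k≡) (octuple h)))
                    (#sqrt1-four-roots h dichotomy)
  where
  h : ℕ
  h = 2 ^ k ∸ 1
  2^k≡ : 2 ^ k ≡ suc h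
  2^k≡ = sym (suc-pred (2 ^ k) {{m^n≢0 2 k}})
  octuple : ∀ h → 2 * (2 * (2 * suc h)) ≡ 8 + 8 * h
  octuple = solve-∀
  double : ∀ h → 2 * suc h ≡ 2 + 2 * h
  double = solve-∀
  ¬both : ∀ {v} → ¬ (2 ∣ v × 2 ∣ v + 1)
  ¬both (2∣v , 2∣v+1) = 2∤1+2* 0 (∣m+n∣m⇒∣n 2∣v+1 2∣v)
  dichotomy : ∀ {v} → 2 + 2 * h ∣ v * (v + 1) → 2 + 2 * h ∣ v ⊎ 2 + 2 * h ∣ v + 1
  dichotomy {v} H∣ rewrite sym (trans (cong (2 *_) 2^k≡) (double h)) =
    prime^-dichotomy (suc k) v (v + 1) prime[2] ¬both H∣

#sqrt1-odd : ∀ m .{{_ : NonZero m}} → 2 ∤ m → #sqrt1 m ≡ 2 ^ ω m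
#sqrt1-odd m = go m (<-wellFounded m)
  where
  go : ∀ m .{{_ : NonZero m}} → Acc _<_ m → 2 ∤ m → #sqrt1 m ≡ 2 ^ ω m
  go 1 _ _ = refl
  go m@(suc (suc _)) (acc smaller) 2∤m with p , p-prime , p∣m ← prime-divisor m (s≤s (s≤s z≤n))
                                       with p-adic-split (prime≥2 p-prime) m
  ... | zero  , m′ , m≡ , p∤m′ , _   = ⊥-elim (p∤m′ (subst (p ∣_) (trans m≡ (*-identityˡ m′)) p∣m))
  ... | suc k , m′ , m≡ , p∤m′ , 0<m′ = begin
    #sqrt1 m                             ≡⟨ #sqrt1-cong m≡ ⟩
    #sqrt1 (p ^ suc k * m′)              ≡⟨ CRT.#sqrt1-* (p ^ suc k) m′ (prime^∣∧∣⇒∣ (suc k) p-prime p∤m′) ⟩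
    #sqrt1 (p ^ suc k) * #sqrt1 m′       ≡⟨ cong₂ _*_ (#sqrt1-odd-prime^ k p-prime p≢2) (go m′ (smaller m′<m) 2∤m′) ⟩
    2 * 2 ^ ω m′                         ≡⟨ cong (2 ^_) (sym (trans (cong ω m≡) (ω-prime^* k p-prime p∤m′))) ⟩
    2 ^ ω m                              ∎
    where
    open ≡-Reasoning
    instance
      _ = prime⇒nonZero p-prime
      _ = m^n≢0 p (suc k)
      _ = >-nonZero 0<m′
      _ = m*n≢0 (p ^ suc k) m′
    p≢2 : p ≢ 2
    p≢2 refl = 2∤m p∣m
    2∤m′ : 2 ∤ m′
    2∤m′ 2∣m′ = 2∤m (subst (2 ∣_) (sym m≡) (∣n⇒∣m*n (p ^ suc k) 2∣m′))
    m′<m : m′ < m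
    m′<m = subst (m′ <_) (trans (*-comm m′ (p ^ suc k)) (sym m≡))
                 (m<m*n m′ (p ^ suc k) (≤-trans (prime≥2 p-prime) (m≤m*n p (p ^ k) {{m^n≢0 p k}})))

#sqrt1-4* : ∀ n .{{_ : NonZero n}} .{{_ : NonZero (4 * n)}} → #sqrt1 (4 * n) ≡ 2 ^ suc (ω n)
#sqrt1-4* n with p-adic-split (s≤s (s≤s z≤n)) n
... | e , o , n≡ , 2∤o , 0<o = go e n≡
  where
  instance _ = >-nonZero 0<o
  go : ∀ e → n ≡ 2 ^ e * o → #sqrt1 (4 * n) ≡ 2 ^ suc (ω n)
  go zero n≡ = begin
    #sqrt1 (4 * n)                  ≡⟨ #sqrt1-cong (cong (4 *_) n≡o) ⟩
    #sqrt1 (4 * o)                  ≡⟨ CRT.#sqrt1-* 4 o (prime^∣∧∣⇒∣ 2 prime[2] 2∤o) ⟩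
    #sqrt1 4 * #sqrt1 o             ≡⟨ cong (2 *_) (#sqrt1-odd o 2∤o) ⟩  -- #sqrt1 4 evaluates to 2
    2 * 2 ^ ω o                     ≡⟨ cong (λ x → 2 ^ suc (ω x)) (sym n≡o) ⟩
    2 ^ suc (ω n)                   ∎
    where
    open ≡-Reasoning
    instance _ = m*n≢0 4 o
    n≡o : n ≡ o
    n≡o = trans n≡ (*-identityˡ o)
  go (suc e) n≡ = begin
    #sqrt1 (4 * n)                        ≡⟨ #sqrt1-cong (trans (cong (4 *_) n≡) (regroup (2 ^ e) o)) ⟩
    #sqrt1 (2 ^ (3 + e) * o)              ≡⟨ CRT.#sqrt1-* (2 ^ (3 + e)) o (prime^∣∧∣⇒∣ (3 + e) prime[2] 2∤o) ⟩
    #sqrt1 (2 ^ (3 + e)) * #sqrt1 o       ≡⟨ cong₂ _*_ (#sqrt1-2^ e) (#sqrt1-odd o 2∤o) ⟩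
    4 * 2 ^ ω o                           ≡⟨ *-assoc 2 2 (2 ^ ω o) ⟩
    2 ^ suc (suc (ω o))                   ≡⟨ cong (λ x → 2 ^ suc x) (sym (trans (cong ω n≡) (ω-prime^* e prime[2] 2∤o))) ⟩
    2 ^ suc (ω n)                         ∎
    where
    open ≡-Reasoning
    instance
      _ = m^n≢0 2 (3 + e)
      _ = m*n≢0 (2 ^ (3 + e)) o
    regroup : ∀ x o → 4 * (2 * x * o) ≡ 2 * (2 * (2 * x)) * o
    regroup = solve-∀


open import Data.Integer as ℤ using (ℤ; +_; _-_)
open import Data.Integer.Properties using (pos-+; pos-*; +-injective)
import Data.Integer.Tactic.RingSolver as ℤ-Ring

-- The left-hand side of the conclusion has the shape of the definition of M.
M-rearrangement : ∀ (F N E P m G₀ G₂ G₄ H₀ H₁ H₂ : ℤ) →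
  F ≡ E ℤ.* P ℤ.* (G₀ ℤ.* H₀) →
  N ℤ.+ E ℤ.* (G₄ ℤ.* H₀ ℤ.+ m ℤ.* m ℤ.* (G₀ ℤ.* H₂) ℤ.+ + 2 ℤ.* m ℤ.* (G₀ ℤ.* H₁))
    ≡ E ℤ.* (P ℤ.* (G₀ ℤ.* H₀) ℤ.+ + 2 ℤ.* (G₂ ℤ.* H₀) ℤ.+ + 2 ℤ.* m ℤ.* (G₂ ℤ.* H₁)) →
  F - E ℤ.* (G₄ ℤ.* H₀ - + 2 ℤ.* G₂ ℤ.* H₀ - + 2 ℤ.* m ℤ.* G₂ ℤ.* H₁
             ℤ.+ m ℤ.* m ℤ.* G₀ ℤ.* H₂ ℤ.+ + 2 ℤ.* m ℤ.* G₀ ℤ.* H₁)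
    ≡ N
M-rearrangement F N E P m G₀ G₂ G₄ H₀ H₁ H₂ refl eq = begin
  E ℤ.* P ℤ.* (G₀ ℤ.* H₀) - E ℤ.* (G₄ ℤ.* H₀ - + 2 ℤ.* G₂ ℤ.* H₀ - + 2 ℤ.* m ℤ.* G₂ ℤ.* H₁
                                  ℤ.+ m ℤ.* m ℤ.* G₀ ℤ.* H₂ ℤ.+ + 2 ℤ.* m ℤ.* G₀ ℤ.* H₁)
    ≡⟨ regroup E P m G₀ G₂ G₄ H₀ H₁ H₂ ⟩
  upper - lower
    ≡⟨ cong (λ x → x - lower) (sym eq) ⟩
  N ℤ.+ lower - lower
    ≡⟨ cancel N lower ⟩
  N ∎
  where
  open ≡-Reasoning
  lower upper : ℤ
  lower = E ℤ.* (G₄ ℤ.* H₀ ℤ.+ m ℤ.* m ℤ.* (G₀ ℤ.* H₂) ℤ.+ + 2 ℤ.* m ℤ.* (G₀ ℤ.* H₁))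
  upper = E ℤ.* (P ℤ.* (G₀ ℤ.* H₀) ℤ.+ + 2 ℤ.* (G₂ ℤ.* H₀) ℤ.+ + 2 ℤ.* m ℤ.* (G₂ ℤ.* H₁))
  regroup : ∀ E P m G₀ G₂ G₄ H₀ H₁ H₂ →
    E ℤ.* P ℤ.* (G₀ ℤ.* H₀) - E ℤ.* (G₄ ℤ.* H₀ - + 2 ℤ.* G₂ ℤ.* H₀ - + 2 ℤ.* m ℤ.* G₂ ℤ.* H₁
                                    ℤ.+ m ℤ.* m ℤ.* G₀ ℤ.* H₂ ℤ.+ + 2 ℤ.* m ℤ.* G₀ ℤ.* H₁)
      ≡ E ℤ.* (P ℤ.* (G₀ ℤ.* H₀) ℤ.+ + 2 ℤ.* (G₂ ℤ.* H₀) ℤ.+ + 2 ℤ.* m ℤ.* (G₂ ℤ.* H₁))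
        - E ℤ.* (G₄ ℤ.* H₀ ℤ.+ m ℤ.* m ℤ.* (G₀ ℤ.* H₂) ℤ.+ + 2 ℤ.* m ℤ.* (G₀ ℤ.* H₁))
  regroup = ℤ-Ring.solve-∀
  cancel : ∀ a b → a ℤ.+ b - b ≡ a
  cancel = ℤ-Ring.solve-∀

module _ (m : ℕ) where
  open Digits m

  +X≡ : ∀ r s → + X r s ≡ + G r q₁ t ℤ.* + G s q₂ t
  +X≡ r s = pos-* (G r q₁ t) (G s q₂ t)

  +lower≡ : + (E * (X 4 0 + m * m * X 0 2 + 2 * m * X 0 1))
    ≡ + E ℤ.* (+ G 4 q₁ t ℤ.* + G 0 q₂ t ℤ.+ + m ℤ.* + m ℤ.* (+ G 0 q₁ t ℤ.* + G 2 q₂ t)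
               ℤ.+ + 2 ℤ.* + m ℤ.* (+ G 0 q₁ t ℤ.* + G 1 q₂ t))
  +lower≡ = trans (pos-* E _) (cong (λ x → + E ℤ.* x) (trans (pos-+ (X 4 0 + m * m * X 0 2) (2 * m * X 0 1))
    (cong₂ ℤ._+_ (trans (pos-+ (X 4 0) (m * m * X 0 2))
                        (cong₂ ℤ._+_ (+X≡ 4 0) (trans (pos-* (m * m) (X 0 2)) (cong₂ ℤ._*_ (pos-* m m) (+X≡ 0 2)))))
                 (trans (pos-* (2 * m) (X 0 1)) (cong₂ ℤ._*_ (pos-* 2 m) (+X≡ 0 1))))))

  +upper≡ : + (E * (P * X 0 0 + 2 * X 2 0 + 2 * m * X 2 1))
    ≡ + E ℤ.* (+ P ℤ.* (+ G 0 q₁ t ℤ.* + G 0 q₂ t) ℤ.+ + 2 ℤ.* (+ G 2 q₁ t ℤ.* + G 0 q₂ t)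
               ℤ.+ + 2 ℤ.* + m ℤ.* (+ G 2 q₁ t ℤ.* + G 1 q₂ t))
  +upper≡ = trans (pos-* E _) (cong (λ x → + E ℤ.* x) (trans (pos-+ (P * X 0 0 + 2 * X 2 0) (2 * m * X 2 1))
    (cong₂ ℤ._+_ (trans (pos-+ (P * X 0 0) (2 * X 2 0))
                        (cong₂ ℤ._+_ (trans (pos-* P (X 0 0)) (cong (λ x → + P ℤ.* x) (+X≡ 0 0)))
                                     (trans (pos-* 2 (X 2 0)) (cong (λ x → + 2 ℤ.* x) (+X≡ 2 0)))))
                 (trans (pos-* (2 * m) (X 2 1)) (cong₂ ℤ._*_ (pos-* 2 m) (+X≡ 2 1))))))

  +first≡ : + ((P * (2 ^ (2 * u * (t * t)) ∸ 1)) / suc P) ≡ + E ℤ.* + P ℤ.* (+ G 0 q₁ t ℤ.* + G 0 q₂ t)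
  +first≡ = trans (cong +_ first≡) (trans (pos-* (E * P) (X 0 0)) (cong₂ ℤ._*_ (pos-* E P) (+X≡ 0 0)))

  M≡N : M m ≡ + N
  M≡N = M-rearrangement _ (+ N) (+ E) (+ P) (+ m)
          (+ G 0 q₁ t) (+ G 2 q₁ t) (+ G 4 q₁ t) (+ G 0 q₂ t) (+ G 1 q₂ t) (+ G 2 q₂ t)
          +first≡ (trans (sym (trans (pos-+ N _) (cong (λ x → + N ℤ.+ x) +lower≡))) (trans (cong +_ N-identity) +upper≡))

IsNu2-2^ : ∀ k → IsNu2 (+ (2 ^ k)) k
IsNu2-2^ k = 2^k≢0 ∘ +-injective , ∣-refl , >⇒∤ 2^k<2^k+1
  where
  instance _ = m^n≢0 2 k
  2^k≢0 : 2 ^ k ≢ 0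
  2^k≢0 = ≢-nonZero⁻¹ (2 ^ k)
  2^k<2^k+1 : 2 ^ k < 2 ^ suc k
  2^k<2^k+1 = subst (2 ^ k <_) (*-comm (2 ^ k) 2) (m<m*n (2 ^ k) 2 ≤-refl)

mainTheorem1 : (n : ℕ) → 1 ≤ n →
    Σ ℕ (λ N → (M (4 * n) ≡ + N) ×
      Σ ℕ (λ Q → (HW N ≡ (4 * n + 5) * Q) ×
        IsNu2 (+ Q - + ((4 * n + 1) ^ 2)) (suc (ω n))))
mainTheorem1 n@(suc _) _ =
  N , M≡N m , t * t + R , HW-N , subst (λ x → IsNu2 x (suc (ω n))) (sym Q-t²≡) (IsNu2-2^ (suc (ω n)))
  where
  m : ℕ
  m = 4 * n
  open Digits m
  R≡ : R ≡ 2 ^ suc (ω n)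
  R≡ = trans (#solutions≡#sqrt1 m (≤-trans (≤ᵇ⇒≤ 2 4 _) (m≤m*n 4 n))) (#sqrt1-4* n)
  Q-t²≡ : + (t * t + R) - + ((m + 1) ^ 2) ≡ + (2 ^ suc (ω n))
  Q-t²≡ = begin
    + (t * t + R) - + ((m + 1) ^ 2)    ≡⟨ cong₂ (λ x y → x - + y) (pos-+ (t * t) R) t²≡ ⟩
    + (t * t) ℤ.+ + R - + (t * t)      ≡⟨ cancel (+ (t * t)) (+ R) ⟩
    + R                                 ≡⟨ cong +_ R≡ ⟩
    + (2 ^ suc (ω n))                   ∎
    where
    open ≡-Reasoning
    t²≡ : (m + 1) ^ 2 ≡ t * t
    t²≡ = trans (cong (λ x → x * (x * 1)) (+-comm m 1)) (cong (t *_) (*-identityʳ t))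
    cancel : ∀ a b → a ℤ.+ b - a ≡ b
    cancel = ℤ-Ring.solve-∀
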